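{- Let $p$ be a prime number such that $p-2$ is also prime and $p \equiv 5 \pmod 8$. Consider the elliptic curves \[ E': Y^2 = X^3 + 2(p+2)X^2 + (p-2)^2 X, \qquad E'': Y^2 = X^3 - 4(p+2)X^2 + 32p X, \] (note $E''$ is isomorphic over $\mathbb{Q}$ to $E: y^2 = x^3-(p+2)x^2+2px = x(x-p)(x-2)$ via $(X,Y) = (4x, 8y)$), and the dual isogeny of degree $2$ \[ \hat{\phi}: E' \to E'', \qquad \hat{\phi}(X,Y) = \left( \frac{Y^2}{X^2}, \frac{Y((p-2)^2 - X^2)}{X^2} \right), \] with kernel $\{\mathcal{O},(0,0)\}$. Then the $\hat{\phi}$-Selmer group is \[ S^{(\hat{\phi})}(E'/\mathbb{Q}) = \{1, 2, p, 2p\} \subset \mathbb{Q}^*/\mathbb{Q}^{*2}. \]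
   Context: Write $E': Y^2 = X^3 + a'X^2 + b'X$ with $a' = 2(p+2)$, $b' = (p-2)^2$, so $a'^2 - 4b' = 32p$. Let $S = \{\infty, 2, p, p-2\}$ (the infinite place together with the primes dividing $2b'(a'^2-4b')$). Let $\mathbb{Q}(S,2) = \{ d \in \mathbb{Q}^*/\mathbb{Q}^{*2} : \operatorname{ord}_v(d) \equiv 0 \pmod 2 \text{ for all primes } v \notin S\}$, i.e. the classes of $\pm1,\pm2,\pm p,\pm(p-2),\pm2p,\pm2(p-2),\pm p(p-2),\pm2p(p-2)$. For $d \in \mathbb{Q}(S,2)$ let $C_d$ be the homogeneous space $C_d: d w^2 = d^2 - 2a' d z^2 + (a'^2 - 4b') z^4$, i.e. $d w^2 = d^2 - 4(p+2) d z^2 + 32p z^4$. The $\hat{\phi}$-Selmer group is $S^{(\hat{\phi})}(E'/\mathbb{Q}) = \{ d \in \mathbb{Q}(S,2) : C_d(\mathbb{Q}_v) \neq \varnothing \text{ for all } v \in S \}$, where $\mathbb{Q}_\infty = \mathbb{R}$ and $\mathbb{Q}_v$ is the $v$-adic field for primes $v$. -}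

module Defs where

open import Data.Bool using (Bool; true; false; if_then_else_)
open import Data.Nat as ℕ using (ℕ; suc; _∸_; _^_)
open import Data.Nat.Divisibility using (_∣_)
open import Data.Integer as ℤ using (ℤ; +_; -[1+_])
open import Data.Rational as ℚ using (ℚ; _/_; _+_; _*_; _-_; ∣_∣; _≤_)
open import Data.Product using (Σ; ∃; _×_)
open import Data.List using (List; []; _∷_)
open import Data.List.Relation.Unary.All using (All)

data Place : Set where
  ∞   : Place
  fin : ℕ → Place

-- Small v k x : "|x|_v ≤ ε_k" where ε_k = 1/(k+1) at ∞ and ε_k = q^{-k} at q.
-- For a normalised rational x (numerator coprime to denominator),
-- |x|_q ≤ q^{-k}  iff  q^k divides the numerator.
Small : Place → ℕ → ℚ → Set
Small ∞       k x = ∣ x ∣ ≤ (+ 1 / suc k)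
Small (fin q) k x = (q ^ k) ∣ ℤ.∣ ℚ.numerator x ∣

-- Cauchy sequences of rationals for |·|_v (these represent elements of ℚ_v,
-- the completion of ℚ at v: ℝ for v = ∞, the q-adic field for v = q).
Cauchy : Place → (ℕ → ℚ) → Set
Cauchy v s = ∀ k → ∃ λ N → ∀ m n → N ℕ.≤ m → N ℕ.≤ n → Small v k (s m - s n)

TendsToZero : Place → (ℕ → ℚ) → Set
TendsToZero v s = ∀ k → ∃ λ N → ∀ n → N ℕ.≤ n → Small v k (s n)

ℤtoℚ : ℤ → ℚ
ℤtoℚ n = n / 1

ℕtoℚ : ℕ → ℚ
ℕtoℚ n = + n / 1

curveRes : ℕ → ℚ → ℚ → ℚ → ℚ
curveRes p d z w =
  d * (w * w) - ((d * d - ℕtoℚ (4 ℕ.* (p ℕ.+ 2)) * d * (z * z)) + ℕtoℚ (32 ℕ.* p) * (z * z * z * z))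

-- C_d(ℚ_v) ≠ ∅ : there are z, w ∈ ℚ_v (given as limits of Cauchy sequences
-- of rationals) with d w² = d² - 4(p+2) d z² + 32 p z⁴ in ℚ_v.
HasLocalPoint : Place → ℕ → ℤ → Set
HasLocalPoint v p d =
  Σ (ℕ → ℚ) λ z → Σ (ℕ → ℚ) λ w →
    Cauchy v z × Cauchy v w × TendsToZero v (λ n → curveRes p (ℤtoℚ d) (z n) (w n))

S : ℕ → List Place
S p = ∞ ∷ fin 2 ∷ fin p ∷ fin (p ∸ 2) ∷ []

-- d ∈ S^(φ̂)(E'/ℚ)   (for d a representative of a class in ℚ(S,2))
InSelmer : ℕ → ℤ → Set
InSelmer p d = All (λ v → HasLocalPoint v p d) (S p)

-- Representatives of the 16 classes of ℚ(S,2):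
-- rep p s a b c = (-1)^s · 2^a · p^b · (p-2)^c  with s,a,b,c ∈ {0,1}.
bit : Bool → ℕ
bit true  = 1
bit false = 0

rep : ℕ → Bool → Bool → Bool → Bool → ℤ
rep p s a b c =
  (if s then -[1+ 0 ] else + 1) ℤ.* (+ (2 ^ bit a ℕ.* p ^ bit b ℕ.* (p ∸ 2) ^ bit c))

{-# OPTIONS --safe #-}
module Submission where

-- C_d has a point over ℚ_v iff the residual d w² − (d² − 4(p+2) d z² + 32 p z⁴) can be made
-- v-adically small.
--  * d < 0: minus the residual is at least d² ≥ 1, so there is no real point.
--  * (p − 2) ∣ d: with q = p − 2 and d = q e, 32 p ≡ 64 is a q-adic unit, and a case split on
--    the q-adic valuations of z and w shows that the residual never vanishes modulo q³.
--  * d = 1, 2, p: C_d has the rational points (z, w) = (0, 1), (1/2, 0), (1/2, 0).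
--  * d = 2p: over ℝ take w = 0 and z → 1/√2, a root of the factor 1 − 2z². At ℓ = 2, p, p − 2
--    a rational z makes the right-hand side 2p g² (1 + 4ℓs) with s ℓ-integral, and 1 + 4ℓs is
--    an ℓ-adic square, approximated by iterating r ↦ s − ℓ r².

open import Defs
open import Agda.Builtin.FromNat using (Number; fromNat)
open import Data.Bool using (Bool; true; false)
open import Data.Empty using (⊥; ⊥-elim)
open import Data.Integer as ℤ using (ℤ; +_; -[1+_]; +[1+_])
import Data.Integer.Divisibility.Signed as ℤ∣
import Data.Integer.GCD as ℤGCD
import Data.Integer.Properties as ℤP
open import Data.Integer.Tactic.RingSolver using () renaming (ring to ℤ-ring)
open import Data.List.Relation.Unary.All using ([]; _∷_)
open import Data.Nat as ℕ using (ℕ; zero; suc; _^_; z≤n; s≤s)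
open import Data.Nat.Coprimality using (recompute)
open import Data.Nat.Divisibility
  using (_∣_; _∣?_; _∣0; 1∣_; divides; ∣-refl; ∣-trans; ∣⇒≤; ∣1⇒≡1; m∣m*n; ∣m⇒∣m*n; ∣m+n∣m⇒∣n; *-monoʳ-∣; *-cancelˡ-∣)
import Data.Nat.Literals as ℕL
open import Data.Nat.Primality using (Prime; prime[2]; euclidsLemma; prime⇒nonZero; prime⇒nonTrivial)
import Data.Nat.Properties as ℕP
open import Data.Nat.Tactic.RingSolver using () renaming (ring to ℕ-ring)
open import Data.Product using (Σ; _×_; _,_; proj₁; proj₂)
open import Data.Rational as ℚ using (ℚ; mkℚ; 0ℚ; 1ℚ; _/_; ↥_; ↧_; toℚᵘ)
import Data.Rational.Literals as ℚL
import Data.Rational.Properties as ℚP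
open import Data.Rational.Unnormalised as ℚᵘ using (mkℚᵘ; *≡*)
import Data.Rational.Unnormalised.Properties as ℚᵘP
open import Data.Sum using (_⊎_; inj₁; inj₂; [_,_]′)
open import Data.Unit.Base using (tt)  -- discharges the ⊤ constraint of numeric literals
open import Function using (_∘_; id)
open import Level using (0ℓ)
open import Relation.Binary.PropositionalEquality
  using (_≡_; _≢_; refl; sym; trans; cong; cong₂; subst; subst₂; module ≡-Reasoning)
open import Relation.Nullary using (¬_; Dec; yes; no)
open import Relation.Nullary.Decidable using (map′; dec⇒maybe)
open import Tactic.RingSolver using (solve-∀)
open import Tactic.RingSolver.Core.AlmostCommutativeRing using (AlmostCommutativeRing; fromCommutativeRing)

instance
  ℕ-number : Number ℕ
  ℕ-number = ℕL.number

  ℚ-number : Number ℚ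
  ℚ-number = ℚL.number

ℚ-ring : AlmostCommutativeRing 0ℓ 0ℓ
ℚ-ring = fromCommutativeRing ℚP.+-*-commutativeRing (λ x → dec⇒maybe (0ℚ ℚP.≟ x))

module Embedding where
  open import Data.Rational using (_+_; _*_; _-_; -_)

  toℚᵘ-ℤtoℚ : ∀ i → toℚᵘ (ℤtoℚ i) ℚᵘ.≃ mkℚᵘ i 0
  toℚᵘ-ℤtoℚ i = ℚP.toℚᵘ-fromℚᵘ (mkℚᵘ i 0)

  ℤtoℚ-+ : ∀ i j → ℤtoℚ (i ℤ.+ j) ≡ ℤtoℚ i + ℤtoℚ j
  ℤtoℚ-+ i j = ℚP.toℚᵘ-injective (begin
    toℚᵘ (ℤtoℚ (i ℤ.+ j))             ≈⟨ toℚᵘ-ℤtoℚ (i ℤ.+ j) ⟩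
    mkℚᵘ (i ℤ.+ j) 0                  ≈⟨ *≡* (cong (ℤ._* + 1) (cong₂ ℤ._+_ (sym (ℤP.*-identityʳ i)) (sym (ℤP.*-identityʳ j)))) ⟩
    mkℚᵘ i 0 ℚᵘ.+ mkℚᵘ j 0            ≈⟨ ℚᵘP.+-cong (toℚᵘ-ℤtoℚ i) (toℚᵘ-ℤtoℚ j) ⟨
    toℚᵘ (ℤtoℚ i) ℚᵘ.+ toℚᵘ (ℤtoℚ j)  ≈⟨ ℚP.toℚᵘ-homo-+ (ℤtoℚ i) (ℤtoℚ j) ⟨
    toℚᵘ (ℤtoℚ i + ℤtoℚ j)            ∎)
    where open ℚᵘP.≃-Reasoning

  ℤtoℚ-* : ∀ i j → ℤtoℚ (i ℤ.* j) ≡ ℤtoℚ i * ℤtoℚ j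
  ℤtoℚ-* i j = ℚP.toℚᵘ-injective (begin
    toℚᵘ (ℤtoℚ (i ℤ.* j))             ≈⟨ toℚᵘ-ℤtoℚ (i ℤ.* j) ⟩
    mkℚᵘ i 0 ℚᵘ.* mkℚᵘ j 0            ≈⟨ ℚᵘP.*-cong (toℚᵘ-ℤtoℚ i) (toℚᵘ-ℤtoℚ j) ⟨
    toℚᵘ (ℤtoℚ i) ℚᵘ.* toℚᵘ (ℤtoℚ j)  ≈⟨ ℚP.toℚᵘ-homo-* (ℤtoℚ i) (ℤtoℚ j) ⟨
    toℚᵘ (ℤtoℚ i * ℤtoℚ j)            ∎)
    where open ℚᵘP.≃-Reasoning

  ℤtoℚ-neg : ∀ i → ℤtoℚ (ℤ.- i) ≡ - ℤtoℚ i
  ℤtoℚ-neg i = ℚP.toℚᵘ-injective (begin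
    toℚᵘ (ℤtoℚ (ℤ.- i))   ≈⟨ toℚᵘ-ℤtoℚ (ℤ.- i) ⟩
    ℚᵘ.- mkℚᵘ i 0         ≈⟨ ℚᵘP.-‿cong (toℚᵘ-ℤtoℚ i) ⟨
    ℚᵘ.- toℚᵘ (ℤtoℚ i)    ≈⟨ ℚP.toℚᵘ-homo‿- (ℤtoℚ i) ⟨
    toℚᵘ (- ℤtoℚ i)       ∎)
    where open ℚᵘP.≃-Reasoning

  ℤtoℚ-injective : ∀ {i j} → ℤtoℚ i ≡ ℤtoℚ j → i ≡ j
  ℤtoℚ-injective {i} {j} eq with ℚᵘP.≃-trans (ℚᵘP.≃-sym (toℚᵘ-ℤtoℚ i)) (ℚᵘP.≃-trans (ℚP.toℚᵘ-cong eq) (toℚᵘ-ℤtoℚ j))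
  ... | *≡* e = trans (sym (ℤP.*-identityʳ i)) (trans e (ℤP.*-identityʳ j))

  ℕtoℚ-+ : ∀ m n → ℕtoℚ (m ℕ.+ n) ≡ ℕtoℚ m + ℕtoℚ n
  ℕtoℚ-+ m n = trans (cong ℤtoℚ (ℤP.pos-+ m n)) (ℤtoℚ-+ (+ m) (+ n))

  ℕtoℚ-* : ∀ m n → ℕtoℚ (m ℕ.* n) ≡ ℕtoℚ m * ℕtoℚ n
  ℕtoℚ-* m n = trans (cong ℤtoℚ (ℤP.pos-* m n)) (ℤtoℚ-* (+ m) (+ n))

  ℕtoℚ-∸ : ∀ {m n} → n ℕ.≤ m → ℕtoℚ (m ℕ.∸ n) ≡ ℕtoℚ m - ℕtoℚ n
  ℕtoℚ-∸ {m} {n} n≤m = trans (add-sub (ℕtoℚ (m ℕ.∸ n)) (ℕtoℚ n))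
    (cong (_- ℕtoℚ n) (trans (sym (ℕtoℚ-+ (m ℕ.∸ n) n)) (cong ℕtoℚ (ℕP.m∸n+n≡m n≤m))))
    where
    add-sub : ∀ x y → x ≡ (x + y) - y
    add-sub = solve-∀ ℚ-ring

  1≤ℕtoℚ : ∀ {n} → 1 ℕ.≤ n → 1ℚ ℚ.≤ ℕtoℚ n
  1≤ℕtoℚ {suc m} _ = subst (1ℚ ℚ.≤_) (sym (ℕtoℚ-+ 1 m))
    (ℚP.≤-trans (ℚP.≤-reflexive (sym (ℚP.+-identityʳ 1ℚ))) (ℚP.+-monoʳ-≤ 1ℚ (ℚP.nonNegative⁻¹ (ℕtoℚ m) {{ℚP.normalize-nonNeg m 1}})))

  *-ℤtoℚ-↧ : ∀ x → x * ℤtoℚ (↧ x) ≡ ℤtoℚ (↥ x)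
  *-ℤtoℚ-↧ x@(mkℚ n d _) = ℚP.toℚᵘ-injective (begin
    toℚᵘ (x * ℤtoℚ (+ suc d))         ≈⟨ ℚP.toℚᵘ-homo-* x (ℤtoℚ (+ suc d)) ⟩
    mkℚᵘ n d ℚᵘ.* toℚᵘ (ℤtoℚ (+ suc d)) ≈⟨ ℚᵘP.*-cong ℚᵘP.≃-refl (toℚᵘ-ℤtoℚ (+ suc d)) ⟩
    mkℚᵘ n d ℚᵘ.* mkℚᵘ (+ suc d) 0    ≈⟨ *≡* (trans (ℤP.*-identityʳ _) (cong (n ℤ.*_) (cong +_ (sym (ℕP.*-identityʳ (suc d)))))) ⟩
    mkℚᵘ n 0                          ≈⟨ toℚᵘ-ℤtoℚ n ⟨
    toℚᵘ (ℤtoℚ n)                     ∎)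
    where open ℚᵘP.≃-Reasoning

  cross-multiply : ∀ x b a → x * ℤtoℚ b ≡ ℤtoℚ a → ↥ x ℤ.* b ≡ a ℤ.* ↧ x
  cross-multiply x@(mkℚ n d _) b a eq
    with ℚᵘP.≃-trans (ℚᵘP.*-cong ℚᵘP.≃-refl (ℚᵘP.≃-sym (toℚᵘ-ℤtoℚ b)))
           (ℚᵘP.≃-trans (ℚᵘP.≃-sym (ℚP.toℚᵘ-homo-* x (ℤtoℚ b))) (ℚᵘP.≃-trans (ℚP.toℚᵘ-cong eq) (toℚᵘ-ℤtoℚ a)))
  ... | *≡* e = trans (sym (ℤP.*-identityʳ (n ℤ.* b))) (trans e (cong (a ℤ.*_) (cong +_ (ℕP.*-identityʳ (suc d)))))

  ℤtoℚ-*-cancelˡ : ∀ c .{{_ : ℤ.NonZero c}} x y → ℤtoℚ c * x ≡ ℤtoℚ c * y → x ≡ y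
  ℤtoℚ-*-cancelˡ c x@(mkℚ nx dx _) y@(mkℚ ny dy _) eq
    with ℚᵘP.≃-trans (ℚᵘP.*-cong (ℚᵘP.≃-sym (toℚᵘ-ℤtoℚ c)) ℚᵘP.≃-refl)
           (ℚᵘP.≃-trans (ℚᵘP.≃-sym (ℚP.toℚᵘ-homo-* (ℤtoℚ c) x))
             (ℚᵘP.≃-trans (ℚP.toℚᵘ-cong eq) (ℚᵘP.≃-trans (ℚP.toℚᵘ-homo-* (ℤtoℚ c) y) (ℚᵘP.*-cong (toℚᵘ-ℤtoℚ c) ℚᵘP.≃-refl))))
  ... | *≡* e = ℚP.toℚᵘ-injective (*≡* (ℤP.*-cancelˡ-≡ c _ _ (begin
    c ℤ.* (nx ℤ.* + suc dy)     ≡⟨ ℤP.*-assoc c nx (+ suc dy) ⟨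
    c ℤ.* nx ℤ.* + suc dy       ≡⟨ cong (λ t → c ℤ.* nx ℤ.* + t) (ℕP.*-identityˡ (suc dy)) ⟨
    c ℤ.* nx ℤ.* + (1 ℕ.* suc dy) ≡⟨ e ⟩
    c ℤ.* ny ℤ.* + (1 ℕ.* suc dx) ≡⟨ cong (λ t → c ℤ.* ny ℤ.* + t) (ℕP.*-identityˡ (suc dx)) ⟩
    c ℤ.* ny ℤ.* + suc dx       ≡⟨ ℤP.*-assoc c ny (+ suc dx) ⟩
    c ℤ.* (ny ℤ.* + suc dx)     ∎)))
    where open ≡-Reasoning

module Valuation (q : ℕ) (q-prime : Prime q) where
  open import Data.Rational using (_+_; _*_; _-_; -_)
  open Embedding

  instance
    q≢0 : ℕ.NonZero q
    q≢0 = prime⇒nonZero q-prime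

  q≢1 : q ≢ 1
  q≢1 = ℕ.nonTrivial⇒≢1 {{prime⇒nonTrivial q-prime}}

  q∤1 : ¬ q ∣ 1
  q∤1 = q≢1 ∘ ∣1⇒≡1

  q∤* : ∀ {m n} → ¬ q ∣ m → ¬ q ∣ n → ¬ q ∣ m ℕ.* n
  q∤* q∤m q∤n q∣mn = [ q∤m , q∤n ]′ (euclidsLemma _ _ q-prime q∣mn)

  q∤^ : ∀ {m} → ¬ q ∣ m → ∀ k → ¬ q ∣ m ^ k
  q∤^ q∤m zero    = q∤1
  q∤^ q∤m (suc k) = q∤* q∤m (q∤^ q∤m k)

  q∤*ℤ : ∀ i j → ¬ q ∣ ℤ.∣ i ∣ → ¬ q ∣ ℤ.∣ j ∣ → ¬ q ∣ ℤ.∣ i ℤ.* j ∣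
  q∤*ℤ i j q∤i q∤j = q∤* q∤i q∤j ∘ subst (q ∣_) (ℤP.abs-* i j)

  q^k∣m*b⇒q^k∣m : ∀ k m b → q ^ k ∣ m ℕ.* b → ¬ q ∣ b → q ^ k ∣ m
  q^k∣m*b⇒q^k∣m zero    m b _ _ = 1∣ m
  q^k∣m*b⇒q^k∣m (suc k) m b h q∤b with euclidsLemma m b q-prime (∣-trans (m∣m*n (q ^ k)) h)
  ... | inj₂ q∣b = ⊥-elim (q∤b q∣b)
  ... | inj₁ (divides m′ refl) = subst (q ^ suc k ∣_) (ℕP.*-comm q m′) (*-monoʳ-∣ q (q^k∣m*b⇒q^k∣m k m′ b h′ q∤b))
    where
    reassoc : m′ ℕ.* q ℕ.* b ≡ q ℕ.* (m′ ℕ.* b)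
    reassoc = trans (cong (ℕ._* b) (ℕP.*-comm m′ q)) (ℕP.*-assoc q m′ b)
    h′ : q ^ k ∣ m′ ℕ.* b
    h′ = *-cancelˡ-∣ q (subst (q ^ suc k ∣_) reassoc h)

  -- v_q(x) ≥ k, witnessed by x = q^k · a / b with q ∤ b.
  record Val≥ (k : ℕ) (x : ℚ) : Set where
    constructor val≥
    field
      num      : ℤ
      den      : ℤ
      q∤den    : ¬ q ∣ ℤ.∣ den ∣
      equation : x * ℤtoℚ den ≡ ℤtoℚ (+ (q ^ k) ℤ.* num)

  Val≥-q^k* : ∀ k a → Val≥ k (ℤtoℚ (+ (q ^ k) ℤ.* a))
  Val≥-q^k* k a = val≥ a (+ 1) q∤1 (ℚP.*-identityʳ _)

  Val≥-ℤtoℚ : ∀ i → Val≥ 0 (ℤtoℚ i)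
  Val≥-ℤtoℚ i = subst (Val≥ 0) (cong ℤtoℚ (ℤP.*-identityˡ i)) (Val≥-q^k* 0 i)

  Val≥-fraction : ∀ {x a b} → x * ℤtoℚ b ≡ ℤtoℚ a → ¬ q ∣ ℤ.∣ b ∣ → Val≥ 0 x
  Val≥-fraction {a = a} {b} eq q∤b = val≥ a b q∤b (trans eq (cong ℤtoℚ (sym (ℤP.*-identityˡ a))))

  Val≥-q : Val≥ 1 (ℕtoℚ q)
  Val≥-q = subst (Val≥ 1) (cong ℤtoℚ (trans (ℤP.*-identityʳ _) (cong +_ (ℕP.*-identityʳ q)))) (Val≥-q^k* 1 (+ 1))

  Val≥-0ℚ : ∀ k → Val≥ k 0ℚ
  Val≥-0ℚ k = subst (Val≥ k) (cong ℤtoℚ (ℤP.*-zeroʳ (+ (q ^ k)))) (Val≥-q^k* k (+ 0))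

  Val≥-+ : ∀ {k x y} → Val≥ k x → Val≥ k y → Val≥ k (x + y)
  Val≥-+ {k} {x} {y} (val≥ a b q∤b e) (val≥ a′ b′ q∤b′ e′) =
    val≥ (a ℤ.* b′ ℤ.+ a′ ℤ.* b) (b ℤ.* b′) (q∤*ℤ b b′ q∤b q∤b′) (begin
      (x + y) * ℤtoℚ (b ℤ.* b′)                          ≡⟨ cong ((x + y) *_) (ℤtoℚ-* b b′) ⟩
      (x + y) * (ℤtoℚ b * ℤtoℚ b′)                       ≡⟨ distribute x y (ℤtoℚ b) (ℤtoℚ b′) ⟩
      (x * ℤtoℚ b) * ℤtoℚ b′ + (y * ℤtoℚ b′) * ℤtoℚ b    ≡⟨ cong₂ (λ u v → u * ℤtoℚ b′ + v * ℤtoℚ b) e e′ ⟩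
      ℤtoℚ (Q ℤ.* a) * ℤtoℚ b′ + ℤtoℚ (Q ℤ.* a′) * ℤtoℚ b ≡⟨ cong₂ _+_ (ℤtoℚ-* (Q ℤ.* a) b′) (ℤtoℚ-* (Q ℤ.* a′) b) ⟨
      ℤtoℚ (Q ℤ.* a ℤ.* b′) + ℤtoℚ (Q ℤ.* a′ ℤ.* b)      ≡⟨ ℤtoℚ-+ (Q ℤ.* a ℤ.* b′) (Q ℤ.* a′ ℤ.* b) ⟨
      ℤtoℚ (Q ℤ.* a ℤ.* b′ ℤ.+ Q ℤ.* a′ ℤ.* b)           ≡⟨ cong ℤtoℚ (factor Q a b′ a′ b) ⟩
      ℤtoℚ (Q ℤ.* (a ℤ.* b′ ℤ.+ a′ ℤ.* b))               ∎)
    where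
    open ≡-Reasoning
    Q : ℤ
    Q = + (q ^ k)
    distribute : ∀ x y u v → (x + y) * (u * v) ≡ (x * u) * v + (y * v) * u
    distribute = solve-∀ ℚ-ring
    factor : ∀ Q a b′ a′ b → Q ℤ.* a ℤ.* b′ ℤ.+ Q ℤ.* a′ ℤ.* b ≡ Q ℤ.* (a ℤ.* b′ ℤ.+ a′ ℤ.* b)
    factor = solve-∀ ℤ-ring

  Val≥-neg : ∀ {k x} → Val≥ k x → Val≥ k (- x)
  Val≥-neg {k} {x} (val≥ a b q∤b e) = val≥ (ℤ.- a) b q∤b (begin
    - x * ℤtoℚ b               ≡⟨ ℚP.neg-distribˡ-* x (ℤtoℚ b) ⟨
    - (x * ℤtoℚ b)             ≡⟨ cong -_ e ⟩
    - ℤtoℚ (+ (q ^ k) ℤ.* a)   ≡⟨ ℤtoℚ-neg (+ (q ^ k) ℤ.* a) ⟨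
    ℤtoℚ (ℤ.- (+ (q ^ k) ℤ.* a)) ≡⟨ cong ℤtoℚ (ℤP.neg-distribʳ-* (+ (q ^ k)) a) ⟩
    ℤtoℚ (+ (q ^ k) ℤ.* ℤ.- a) ∎)
    where open ≡-Reasoning

  Val≥-sub : ∀ {k x y} → Val≥ k x → Val≥ k y → Val≥ k (x - y)
  Val≥-sub vx vy = Val≥-+ vx (Val≥-neg vy)

  Val≥-* : ∀ {k j x y} → Val≥ k x → Val≥ j y → Val≥ (k ℕ.+ j) (x * y)
  Val≥-* {k} {j} {x} {y} (val≥ a b q∤b e) (val≥ a′ b′ q∤b′ e′) =
    val≥ (a ℤ.* a′) (b ℤ.* b′) (q∤*ℤ b b′ q∤b q∤b′) (begin
      (x * y) * ℤtoℚ (b ℤ.* b′)                     ≡⟨ cong ((x * y) *_) (ℤtoℚ-* b b′) ⟩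
      (x * y) * (ℤtoℚ b * ℤtoℚ b′)                  ≡⟨ interchange x y (ℤtoℚ b) (ℤtoℚ b′) ⟩
      (x * ℤtoℚ b) * (y * ℤtoℚ b′)                  ≡⟨ cong₂ _*_ e e′ ⟩
      ℤtoℚ (Q ℤ.* a) * ℤtoℚ (Q′ ℤ.* a′)             ≡⟨ ℤtoℚ-* (Q ℤ.* a) (Q′ ℤ.* a′) ⟨
      ℤtoℚ ((Q ℤ.* a) ℤ.* (Q′ ℤ.* a′))              ≡⟨ cong ℤtoℚ (regroup Q Q′ a a′) ⟩
      ℤtoℚ ((Q ℤ.* Q′) ℤ.* (a ℤ.* a′))              ≡⟨ cong (λ t → ℤtoℚ (t ℤ.* (a ℤ.* a′))) q^k*q^j ⟩
      ℤtoℚ (+ (q ^ (k ℕ.+ j)) ℤ.* (a ℤ.* a′))       ∎)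
    where
    open ≡-Reasoning
    Q Q′ : ℤ
    Q = + (q ^ k)
    Q′ = + (q ^ j)
    interchange : ∀ x y u v → (x * y) * (u * v) ≡ (x * u) * (y * v)
    interchange = solve-∀ ℚ-ring
    regroup : ∀ Q Q′ a a′ → (Q ℤ.* a) ℤ.* (Q′ ℤ.* a′) ≡ (Q ℤ.* Q′) ℤ.* (a ℤ.* a′)
    regroup = solve-∀ ℤ-ring
    q^k*q^j : Q ℤ.* Q′ ≡ + (q ^ (k ℕ.+ j))
    q^k*q^j = trans (sym (ℤP.pos-* (q ^ k) (q ^ j))) (cong +_ (sym (ℕP.^-distribˡ-+-* q k j)))

  Val≥-pred : ∀ {k x} → Val≥ (suc k) x → Val≥ k x
  Val≥-pred {k} (val≥ a b q∤b e) =
    val≥ (+ q ℤ.* a) b q∤b (trans e (cong ℤtoℚ (trans (cong (ℤ._* a) (ℤP.pos-* q (q ^ k))) (rotate (+ q) (+ (q ^ k)) a))))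
    where
    rotate : ∀ Q R a → (Q ℤ.* R) ℤ.* a ≡ R ℤ.* (Q ℤ.* a)
    rotate = solve-∀ ℤ-ring

  Val≥-≤ : ∀ {j k x} → j ℕ.≤ k → Val≥ k x → Val≥ j x
  Val≥-≤ j≤k = go (ℕP.≤⇒≤′ j≤k)
    where
    go : ∀ {j k x} → j ℕ.≤′ k → Val≥ k x → Val≥ j x
    go ℕ.≤′-refl       v = v
    go (ℕ.≤′-step j≤k) v = go j≤k (Val≥-pred v)

  Val≥-cancelˡ-ℤ-unit : ∀ {k y} u → ¬ q ∣ ℤ.∣ u ∣ → Val≥ k (ℤtoℚ u * y) → Val≥ k y
  Val≥-cancelˡ-ℤ-unit {y = y} u q∤u (val≥ a b q∤b e) =
    val≥ a (u ℤ.* b) (q∤*ℤ u b q∤u q∤b) (trans (cong (y *_) (ℤtoℚ-* u b)) (trans (swap y (ℤtoℚ u) (ℤtoℚ b)) e))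
    where
    swap : ∀ y u b → y * (u * b) ≡ (u * y) * b
    swap = solve-∀ ℚ-ring

  Val≥-cancelˡ-q^ : ∀ j {k y} → Val≥ (j ℕ.+ k) (ℕtoℚ (q ^ j) * y) → Val≥ k y
  Val≥-cancelˡ-q^ j {k} {y} (val≥ a b q∤b e) =
    val≥ a b q∤b (ℤtoℚ-*-cancelˡ (+ (q ^ j)) {{ℕP.m^n≢0 q j}} (y * ℤtoℚ b) (ℤtoℚ (+ (q ^ k) ℤ.* a)) (begin
      ℕtoℚ (q ^ j) * (y * ℤtoℚ b)            ≡⟨ ℚP.*-assoc (ℕtoℚ (q ^ j)) y (ℤtoℚ b) ⟨
      ℕtoℚ (q ^ j) * y * ℤtoℚ b              ≡⟨ e ⟩
      ℤtoℚ (+ (q ^ (j ℕ.+ k)) ℤ.* a)         ≡⟨ cong (λ t → ℤtoℚ (t ℤ.* a))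
                                                   (trans (cong +_ (ℕP.^-distribˡ-+-* q j k)) (ℤP.pos-* (q ^ j) (q ^ k))) ⟩
      ℤtoℚ (+ (q ^ j) ℤ.* + (q ^ k) ℤ.* a)   ≡⟨ cong ℤtoℚ (ℤP.*-assoc (+ (q ^ j)) (+ (q ^ k)) a) ⟩
      ℤtoℚ (+ (q ^ j) ℤ.* (+ (q ^ k) ℤ.* a)) ≡⟨ ℤtoℚ-* (+ (q ^ j)) (+ (q ^ k) ℤ.* a) ⟩
      ℕtoℚ (q ^ j) * ℤtoℚ (+ (q ^ k) ℤ.* a)  ∎))
    where open ≡-Reasoning

  Val≥-cancelˡ-q : ∀ {k y} → Val≥ (suc k) (ℕtoℚ q * y) → Val≥ k y
  Val≥-cancelˡ-q {y = y} v = Val≥-cancelˡ-q^ 1 (subst (λ t → Val≥ _ (ℕtoℚ t * y)) (sym (ℕP.*-identityʳ q)) v)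

  Val≥⇒Small : ∀ {k x} → Val≥ k x → Small (fin q) k x
  Val≥⇒Small {k} {x} (val≥ a b q∤b e) = q^k∣m*b⇒q^k∣m k _ _ q^k∣↥x*b q∤b
    where
    q^k∣↥x*b : q ^ k ∣ ℤ.∣ ↥ x ∣ ℕ.* ℤ.∣ b ∣
    q^k∣↥x*b = subst (q ^ k ∣_) (begin
      q ^ k ℕ.* ℤ.∣ a ∣ ℕ.* ℤ.∣ ↧ x ∣       ≡⟨ cong (ℕ._* ℤ.∣ ↧ x ∣) (ℤP.abs-* (+ (q ^ k)) a) ⟨
      ℤ.∣ + (q ^ k) ℤ.* a ∣ ℕ.* ℤ.∣ ↧ x ∣   ≡⟨ ℤP.abs-* (+ (q ^ k) ℤ.* a) (↧ x) ⟨
      ℤ.∣ + (q ^ k) ℤ.* a ℤ.* ↧ x ∣         ≡⟨ cong ℤ.∣_∣ (cross-multiply x b (+ (q ^ k) ℤ.* a) e) ⟨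
      ℤ.∣ ↥ x ℤ.* b ∣                       ≡⟨ ℤP.abs-* (↥ x) b ⟩
      ℤ.∣ ↥ x ∣ ℕ.* ℤ.∣ b ∣                 ∎)
      (∣m⇒∣m*n _ (m∣m*n _))
      where open ≡-Reasoning

  Small⇒Val≥ : ∀ {k x} → Small (fin q) (suc k) x → Val≥ (suc k) x
  Small⇒Val≥ {k} {x@(mkℚ n d coprime)} q^k∣n with ℤ∣.∣ᵤ⇒∣ {k = + (q ^ suc k)} {i = n} q^k∣n
  ... | ℤ∣.divides c n≡c*q^k = val≥ c (↧ x) q∤↧x (trans (*-ℤtoℚ-↧ x) (cong ℤtoℚ (trans n≡c*q^k (ℤP.*-comm c _))))
    where
    q∤↧x : ¬ q ∣ ℤ.∣ ↧ x ∣
    q∤↧x q∣d = q≢1 (recompute coprime (∣-trans (m∣m*n (q ^ k)) q^k∣n , q∣d))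

  q∣⇒q^1∣ : ∀ {n} → q ∣ n → q ^ 1 ∣ n
  q∣⇒q^1∣ = subst (_∣ _) (sym (ℕP.*-identityʳ q))

  Val≥1-of-square : ∀ {x} → Val≥ 1 (x * x) → Val≥ 1 x
  Val≥1-of-square {x} v = Small⇒Val≥ {0} (q∣⇒q^1∣ ([ id , id ]′ (euclidsLemma _ _ q-prime q∣↥x*↥x)))
    where
    nf : ℤ
    nf = ℤGCD.gcd (↥ x ℤ.* ↥ x) (↧ x ℤ.* ↧ x)
    q∣↥x² : q ∣ ℤ.∣ ↥ (x * x) ∣
    q∣↥x² = subst (_∣ _) (ℕP.*-identityʳ q) (Val≥⇒Small v)
    q∣↥x*↥x : q ∣ ℤ.∣ ↥ x ∣ ℕ.* ℤ.∣ ↥ x ∣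
    q∣↥x*↥x = subst (q ∣_) (trans (sym (ℤP.abs-* (↥ (x * x)) nf)) (trans (cong ℤ.∣_∣ (ℚP.↥-* x x)) (ℤP.abs-* (↥ x) (↥ x))))
                (∣m⇒∣m*n _ q∣↥x²)

  ¬Val≥1-ℤtoℚ : ∀ u → ¬ q ∣ ℤ.∣ u ∣ → ¬ Val≥ 1 (ℤtoℚ u)
  ¬Val≥1-ℤtoℚ u q∤u (val≥ a b q∤b e) = q∤* q∤u q∤b (subst (q ∣_) (trans (cong ℤ.∣_∣ q*a≡u*b) (ℤP.abs-* u b)) q∣q*a)
    where
    q*a≡u*b : + (q ^ 1) ℤ.* a ≡ u ℤ.* b
    q*a≡u*b = ℤtoℚ-injective (sym (trans (ℤtoℚ-* u b) e))
    q∣q*a : q ∣ ℤ.∣ + (q ^ 1) ℤ.* a ∣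
    q∣q*a = subst (q ∣_) (sym (ℤP.abs-* (+ (q ^ 1)) a)) (∣m⇒∣m*n ℤ.∣ a ∣ (m∣m*n 1))

  Val≥0⊎inverse-Val≥1 : ∀ x → Val≥ 0 x ⊎ Σ ℚ λ y → x * y ≡ 1ℚ × Val≥ 1 y
  Val≥0⊎inverse-Val≥1 x@(mkℚ n d _) with q ∣? suc d
  ... | no q∤d = inj₁ (Val≥-fraction {a = n} {b = + suc d} (*-ℤtoℚ-↧ x) q∤d)
  Val≥0⊎inverse-Val≥1 (mkℚ (+ 0) d coprime) | yes q∣d = ⊥-elim (q≢1 (recompute coprime (q ∣0 , q∣d)))
  Val≥0⊎inverse-Val≥1 x@(mkℚ +[1+ _ ] _ _)  | yes q∣d = inj₂ (ℚ.1/ x , ℚP.*-inverseʳ x , Small⇒Val≥ {0} (q∣⇒q^1∣ q∣d))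
  Val≥0⊎inverse-Val≥1 x@(mkℚ -[1+ _ ] _ _)  | yes q∣d = inj₂ (ℚ.1/ x , ℚP.*-inverseʳ x , Small⇒Val≥ {0} (q∣⇒q^1∣ q∣d))

  module _ (r : ℕ → ℚ) (step : ∀ n → Val≥ n (r (suc n) - r n)) where

    Val≥-telescope-from : ∀ n i → Val≥ n (r (i ℕ.+ n) - r n)
    Val≥-telescope-from n zero    = subst (Val≥ n) (sym (ℚP.+-inverseʳ (r n))) (Val≥-0ℚ n)
    Val≥-telescope-from n (suc i) = subst (Val≥ n) (chain (r (suc i ℕ.+ n)) (r (i ℕ.+ n)) (r n))
      (Val≥-+ (Val≥-≤ (ℕP.m≤n+m n i) (step (i ℕ.+ n))) (Val≥-telescope-from n i))
      where
      chain : ∀ x y z → (x - y) + (y - z) ≡ x - z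
      chain = solve-∀ ℚ-ring

    Val≥-telescope : ∀ N m n → N ℕ.≤ m → N ℕ.≤ n → Val≥ N (r m - r n)
    Val≥-telescope N m n N≤m N≤n with ℕP.≤-total n m
    ... | inj₁ n≤m = Val≥-≤ N≤n (subst (λ t → Val≥ n (r t - r n)) (ℕP.m∸n+n≡m n≤m) (Val≥-telescope-from n (m ℕ.∸ n)))
    ... | inj₂ m≤n = Val≥-≤ N≤m (subst (Val≥ m) (flip (r n) (r m))
                       (Val≥-neg (subst (λ t → Val≥ m (r t - r m)) (ℕP.m∸n+n≡m m≤n) (Val≥-telescope-from m (n ℕ.∸ m)))))
      where
      flip : ∀ x y → - (x - y) ≡ y - x
      flip = solve-∀ ℚ-ring

  Val≥1? : ∀ x → Dec (Val≥ 1 x)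
  Val≥1? x = map′ Small⇒Val≥ Val≥⇒Small (q ^ 1 ∣? ℤ.∣ ↥ x ∣)

  Unit : ℚ → Set
  Unit u = Val≥ 0 u × ¬ Val≥ 1 u

  Unit-ℤtoℚ : ∀ u → ¬ q ∣ ℤ.∣ u ∣ → Unit (ℤtoℚ u)
  Unit-ℤtoℚ u q∤u = Val≥-ℤtoℚ u , ¬Val≥1-ℤtoℚ u q∤u

  Val≥-cancelˡ-unit : ∀ {k u y} → Unit u → Val≥ k (u * y) → Val≥ k y
  Val≥-cancelˡ-unit {u = u} {y} (val≥ a b q∤b e , ¬v₁) v with q ∣? ℤ.∣ a ∣
  ... | no q∤a = Val≥-cancelˡ-ℤ-unit a q∤a (subst (Val≥ _) b*[u*y]≡a*y (Val≥-* (Val≥-ℤtoℚ b) v))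
    where
    b*[u*y]≡a*y : ℤtoℚ b * (u * y) ≡ ℤtoℚ a * y
    b*[u*y]≡a*y = begin
      ℤtoℚ b * (u * y)        ≡⟨ rearrange (ℤtoℚ b) u y ⟩
      (u * ℤtoℚ b) * y        ≡⟨ cong (_* y) e ⟩
      ℤtoℚ (+ 1 ℤ.* a) * y    ≡⟨ cong (λ t → ℤtoℚ t * y) (ℤP.*-identityˡ a) ⟩
      ℤtoℚ a * y              ∎
      where
      open ≡-Reasoning
      rearrange : ∀ b u y → b * (u * y) ≡ (u * b) * y
      rearrange = solve-∀ ℚ-ring
  ... | yes q∣a with ℤ∣.∣ᵤ⇒∣ {k = + q} {i = a} q∣a
  ...   | ℤ∣.divides c a≡c*q = ⊥-elim (¬v₁ (val≥ c b q∤b (trans e (cong ℤtoℚ (begin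
      + 1 ℤ.* a         ≡⟨ ℤP.*-identityˡ a ⟩
      a                 ≡⟨ a≡c*q ⟩
      c ℤ.* + q         ≡⟨ ℤP.*-comm c (+ q) ⟩
      + q ℤ.* c         ≡⟨ cong (λ t → + t ℤ.* c) (ℕP.*-identityʳ q) ⟨
      + (q ^ 1) ℤ.* c   ∎)))))
    where open ≡-Reasoning

  Unit-* : ∀ {u v} → Unit u → Unit v → Unit (u * v)
  Unit-* (vu , ¬v₁u) (vv , ¬v₁v) = Val≥-* vu vv , λ v₁ → ¬v₁v (Val≥-cancelˡ-unit (vu , ¬v₁u) v₁)

module Places where
  open import Data.Rational using (_-_)

  Small-0ℚ : ∀ v k → Small v k 0ℚ
  Small-0ℚ ∞       k = ℚP.nonNegative⁻¹ (+ 1 / suc k) {{ℚP.normalize-nonNeg 1 (suc k)}}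
  Small-0ℚ (fin q) k = (q ^ k) ∣0

  Cauchy-const : ∀ v x → Cauchy v (λ _ → x)
  Cauchy-const v x k = 0 , λ _ _ _ _ → subst (Small v k) (sym (ℚP.+-inverseʳ x)) (Small-0ℚ v k)

module Quartic (A B : ℚ) where
  open import Data.Rational using (_+_; _*_; _-_; -_; _≤_; NonNegative)
  open Embedding
  open Places

  quartic : ℚ → ℚ → ℚ
  quartic d z = (d * d - A * d * (z * z)) + B * (z * z * z * z)

  residual : ℚ → ℚ → ℚ → ℚ
  residual d z w = d * (w * w) - quartic d z

  LocalPoint : Place → ℚ → Set
  LocalPoint v d = Σ (ℕ → ℚ) λ z → Σ (ℕ → ℚ) λ w →
    Cauchy v z × Cauchy v w × TendsToZero v (λ n → residual d (z n) (w n))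

  rational-point : ∀ {v} d z w → residual d z w ≡ 0ℚ → LocalPoint v d
  rational-point {v} d z w on-curve =
    (λ _ → z) , (λ _ → w) , Cauchy-const v z , Cauchy-const v w ,
    λ k → 0 , λ _ _ → subst (Small v k) (sym on-curve) (Small-0ℚ v k)

  module _ {{A≥0 : NonNegative A}} {{B≥0 : NonNegative B}} where

    1≤-residual : ∀ {D} z w → 1ℚ ≤ D → 1ℚ ≤ - residual (- D) z w
    1≤-residual {D} z w 1≤D = begin
      1ℚ                 ≤⟨ 1≤D*D ⟩
      D * D              ≡⟨ ℚP.+-identityʳ (D * D) ⟨
      D * D + 0ℚ         ≤⟨ ℚP.+-monoʳ-≤ (D * D) (ℚP.nonNegative⁻¹ rest {{rest≥0}}) ⟩
      D * D + rest       ≡⟨ expand A B D z w ⟨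
      - residual (- D) z w ∎
      where
      open ℚP.≤-Reasoning
      instance
        D≥0 : NonNegative D
        D≥0 = ℚ.nonNegative (ℚP.≤-trans (ℚP.nonNegative⁻¹ 1ℚ) 1≤D)
      square≥0 : ∀ x → NonNegative (x * x)
      square≥0 x@(mkℚ (+ _) _ _)    = ℚP.nonNeg*nonNeg⇒nonNeg x x
      square≥0 x@(mkℚ -[1+ _ ] _ _) = ℚP.nonPos*nonPos⇒nonPos x x
      rest : ℚ
      rest = D * (w * w) + A * D * (z * z) + B * ((z * z) * (z * z))
      rest≥0 : NonNegative rest
      rest≥0 = ℚP.nonNeg+nonNeg⇒nonNeg (D * (w * w) + A * D * (z * z))
              {{ℚP.nonNeg+nonNeg⇒nonNeg (D * (w * w)) {{ℚP.nonNeg*nonNeg⇒nonNeg D (w * w) {{square≥0 w}}}}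
                 (A * D * (z * z)) {{ℚP.nonNeg*nonNeg⇒nonNeg (A * D) {{ℚP.nonNeg*nonNeg⇒nonNeg A D}} (z * z) {{square≥0 z}}}}}}
              (B * ((z * z) * (z * z))) {{ℚP.nonNeg*nonNeg⇒nonNeg B ((z * z) * (z * z)) {{square≥0 (z * z)}}}}
      1≤D*D : 1ℚ ≤ D * D
      1≤D*D = ℚP.≤-trans 1≤D (ℚP.≤-trans (ℚP.≤-reflexive (sym (ℚP.*-identityʳ D))) (ℚP.*-monoˡ-≤-nonNeg D 1≤D))
      expand : ∀ A B D z w → - ((- D) * (w * w) - (((- D) * (- D) - A * (- D) * (z * z)) + B * (z * z * z * z)))
                             ≡ D * D + (D * (w * w) + A * D * (z * z) + B * ((z * z) * (z * z)))
      expand = solve-∀ ℚ-ring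

    ¬LocalPoint-∞ : ∀ {D} → 1ℚ ≤ D → ¬ LocalPoint ∞ (- D)
    ¬LocalPoint-∞ {D} 1≤D (z , w , _ , _ , →0) = 1≰½ (ℚP.≤-trans 1≤-r -r≤½)
      where
      N : ℕ
      N = proj₁ (→0 1)
      r : ℚ
      r = residual (- D) (z N) (w N)
      1≤-r : 1ℚ ≤ - r
      1≤-r = 1≤-residual (z N) (w N) 1≤D
      nonNeg⇒∣p∣≡p : ∀ p → .{{NonNegative p}} → ℚ.∣ p ∣ ≡ p
      nonNeg⇒∣p∣≡p (mkℚ (+ _) _ _) = refl
      -r≤½ : - r ≤ + 1 / 2
      -r≤½ = subst (_≤ + 1 / 2)
        (trans (sym (ℚP.∣-p∣≡∣p∣ r)) (nonNeg⇒∣p∣≡p (- r) {{ℚ.nonNegative (ℚP.≤-trans (ℚP.nonNegative⁻¹ 1ℚ) 1≤-r)}}))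
        (proj₂ (→0 1) N ℕP.≤-refl)
      1≰½ : ¬ 1ℚ ≤ + 1 / 2
      1≰½ (ℚ.*≤* (ℤ.+≤+ (s≤s ())))

  module QAdicObstruction (q : ℕ) (q-prime : Prime q) {e : ℚ} (e-unit : Valuation.Unit q q-prime e)
                          (A-integral : Valuation.Val≥ q q-prime 0 A) (B-unit : Valuation.Unit q q-prime B) where
    open Valuation q q-prime

    Q X : ℚ
    Q = ℕtoℚ q
    X = Q * e

    Val≥-X : Val≥ 1 X
    Val≥-X = Val≥-* Val≥-q (proj₁ e-unit)

    X-integral : Val≥ 0 X
    X-integral = Val≥-pred Val≥-X

    ¬Val≥2-X : ¬ Val≥ 2 X
    ¬Val≥2-X = proj₂ e-unit ∘ Val≥-cancelˡ-q

    ¬Val≥2-X*square-unit : ∀ V y → Unit V → ¬ Val≥ 2 (X * (y * y) - V)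
    ¬Val≥2-X*square-unit V y (V-integral , ¬Val≥1-V) v₂ = [ integral , nonintegral ]′ (Val≥0⊎inverse-Val≥1 y)
      where
      integral : Val≥ 0 y → ⊥
      integral y-integral = ¬Val≥1-V (subst (Val≥ 1) (cancel (X * (y * y)) V)
        (Val≥-sub (Val≥-* Val≥-X (Val≥-* y-integral y-integral)) (Val≥-pred v₂)))
        where
        cancel : ∀ a b → a - (a - b) ≡ b
        cancel = solve-∀ ℚ-ring
      nonintegral : Σ ℚ (λ ω → y * ω ≡ 1ℚ × Val≥ 1 ω) → ⊥
      nonintegral (ω , yω≡1 , ω-divisible) = ¬Val≥2-X (subst (Val≥ 2) X≡ (Val≥-+
          (Val≥-≤ (ℕP.m≤m+n 2 2) (Val≥-* v₂ (Val≥-* ω-divisible ω-divisible)))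
          (Val≥-* V-integral (Val≥-* ω-divisible ω-divisible))))
        where
        expand : ∀ X y V ω → (X * (y * y) - V) * (ω * ω) + V * (ω * ω) ≡ X * ((y * ω) * (y * ω))
        expand = solve-∀ ℚ-ring
        X≡ : (X * (y * y) - V) * (ω * ω) + V * (ω * ω) ≡ X
        X≡ = trans (expand X y V ω) (trans (cong (λ t → X * (t * t)) yω≡1) (ℚP.*-identityʳ X))

    divisible-z : ∀ z w → Val≥ 1 z → ¬ Val≥ 3 (residual X z w)
    divisible-z z w z-divisible v₃ = [ integral , nonintegral ]′ (Val≥0⊎inverse-Val≥1 w)
      where
      W : ℚ
      W = e * (w * w) - Q * (e * e)
      W-Val≥2 : Val≥ 2 W
      W-Val≥2 = Val≥-cancelˡ-q (subst (Val≥ 3) (sym (expand Q e A B z w)) (Val≥-sub v₃ (Val≥-sub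
        (Val≥-* (Val≥-* A-integral Val≥-X) (Val≥-* z-divisible z-divisible))
        (Val≥-≤ (ℕP.m≤n+m 3 1) (Val≥-* (proj₁ B-unit) (Val≥-* (Val≥-* (Val≥-* z-divisible z-divisible) z-divisible) z-divisible))))))
        where
        expand : ∀ Q e A B z w → Q * (e * (w * w) - Q * (e * e))
          ≡ ((Q * e) * (w * w) - (((Q * e) * (Q * e) - A * (Q * e) * (z * z)) + B * (z * z * z * z)))
            - (A * (Q * e) * (z * z) - B * (z * z * z * z))
        expand = solve-∀ ℚ-ring
      integral : Val≥ 0 w → ⊥
      integral w-integral = proj₂ e-unit (Val≥-cancelˡ-unit e-unit (Val≥-cancelˡ-q Qe²-Val≥2))
        where
        add-back : ∀ a b → (a - b) + b ≡ a
        add-back = solve-∀ ℚ-ring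
        take-away : ∀ a b → a - (a - b) ≡ b
        take-away = solve-∀ ℚ-ring
        w-divisible : Val≥ 1 w
        w-divisible = Val≥1-of-square (Val≥-cancelˡ-unit e-unit (subst (Val≥ 1) (add-back (e * (w * w)) (Q * (e * e)))
          (Val≥-+ (Val≥-pred W-Val≥2) (Val≥-* Val≥-q (Val≥-* (proj₁ e-unit) (proj₁ e-unit))))))
        Qe²-Val≥2 : Val≥ 2 (Q * (e * e))
        Qe²-Val≥2 = subst (Val≥ 2) (take-away (e * (w * w)) (Q * (e * e)))
          (Val≥-sub (Val≥-* (proj₁ e-unit) (Val≥-* w-divisible w-divisible)) W-Val≥2)
      nonintegral : Σ ℚ (λ ω → w * ω ≡ 1ℚ × Val≥ 1 ω) → ⊥
      nonintegral (ω , wω≡1 , ω-divisible) = proj₂ e-unit (subst (Val≥ 1) e≡ (Val≥-+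
        (Val≥-≤ (ℕP.m≤n+m 1 3) (Val≥-* W-Val≥2 (Val≥-* ω-divisible ω-divisible)))
        (Val≥-pred (Val≥-pred (Val≥-* (Val≥-* Val≥-q (Val≥-* (proj₁ e-unit) (proj₁ e-unit))) (Val≥-* ω-divisible ω-divisible))))))
        where
        expand : ∀ Q e w ω → (e * (w * w) - Q * (e * e)) * (ω * ω) + (Q * (e * e)) * (ω * ω) ≡ e * ((w * ω) * (w * ω))
        expand = solve-∀ ℚ-ring
        e≡ : W * (ω * ω) + (Q * (e * e)) * (ω * ω) ≡ e
        e≡ = trans (expand Q e w ω) (trans (cong (λ t → e * (t * t)) wω≡1) (ℚP.*-identityʳ e))

    unit-z : ∀ z w → Unit z → ¬ Val≥ 3 (residual X z w)
    unit-z z w z-unit v₃ = ¬Val≥2-X*square-unit V w (V-integral , ¬Val≥1-V) (Val≥-pred v₃)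
      where
      z⁴-unit : Unit (z * z * z * z)
      z⁴-unit = Unit-* (Unit-* (Unit-* z-unit z-unit) z-unit) z-unit
      V : ℚ
      V = quartic X z
      V-integral : Val≥ 0 V
      V-integral = Val≥-+ (Val≥-sub (Val≥-* X-integral X-integral) (Val≥-* (Val≥-* A-integral X-integral) (proj₁ (Unit-* z-unit z-unit))))
                          (proj₁ (Unit-* B-unit z⁴-unit))
      ¬Val≥1-V : ¬ Val≥ 1 V
      ¬Val≥1-V v₁ = proj₂ (Unit-* B-unit z⁴-unit) (subst (Val≥ 1) (take-away (X * X - A * X * (z * z)) (B * (z * z * z * z)))
        (Val≥-sub v₁ (Val≥-sub (Val≥-* Val≥-X X-integral) (Val≥-* (Val≥-* A-integral Val≥-X) (proj₁ (Unit-* z-unit z-unit))))))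
        where
        take-away : ∀ a b → (a + b) - a ≡ b
        take-away = solve-∀ ℚ-ring

    nonintegral-z : ∀ z w ζ → z * ζ ≡ 1ℚ → Val≥ 1 ζ → ¬ Val≥ 3 (residual X z w)
    nonintegral-z z w ζ zζ≡1 ζ-divisible v₃ = ¬Val≥2-X*square-unit U y (U-integral , ¬Val≥1-U)
      (Val≥-≤ (ℕP.m≤n+m 2 5) (subst (Val≥ 7) scaled (Val≥-* v₃ ζ⁴-Val≥4)))
      where
      ζ²-Val≥2 : Val≥ 2 (ζ * ζ)
      ζ²-Val≥2 = Val≥-* ζ-divisible ζ-divisible
      ζ⁴-Val≥4 : Val≥ 4 (ζ * ζ * ζ * ζ)
      ζ⁴-Val≥4 = Val≥-* (Val≥-* ζ²-Val≥2 ζ-divisible) ζ-divisible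
      R : ℚ
      R = X * X * (ζ * ζ * ζ * ζ) - A * X * (ζ * ζ)
      U : ℚ
      U = B + R
      R-Val≥1 : Val≥ 1 R
      R-Val≥1 = Val≥-sub (Val≥-≤ (ℕP.m≤n+m 1 4) (Val≥-* (Val≥-* Val≥-X X-integral) ζ⁴-Val≥4))
                       (Val≥-≤ (ℕP.m≤m+n 1 2) (Val≥-* (Val≥-* A-integral Val≥-X) ζ²-Val≥2))
      U-integral : Val≥ 0 U
      U-integral = Val≥-+ (proj₁ B-unit) (Val≥-pred R-Val≥1)
      ¬Val≥1-U : ¬ Val≥ 1 U
      ¬Val≥1-U v₁ = proj₂ B-unit (subst (Val≥ 1) (take-away B R) (Val≥-sub v₁ R-Val≥1))
        where
        take-away : ∀ a b → (a + b) - b ≡ a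
        take-away = solve-∀ ℚ-ring
      y : ℚ
      y = w * (ζ * ζ)
      U[_] : ℚ → ℚ
      U[ t ] = B * (t * t * t * t) + (X * X * (ζ * ζ * ζ * ζ) - A * X * (t * t) * (ζ * ζ))
      expand : ∀ X A B z w ζ → (X * (w * w) - ((X * X - A * X * (z * z)) + B * (z * z * z * z))) * (ζ * ζ * ζ * ζ)
        ≡ X * ((w * (ζ * ζ)) * (w * (ζ * ζ)))
          - (B * ((z * ζ) * (z * ζ) * (z * ζ) * (z * ζ)) + (X * X * (ζ * ζ * ζ * ζ) - A * X * ((z * ζ) * (z * ζ)) * (ζ * ζ)))
      expand = solve-∀ ℚ-ring
      simplify : ∀ X A B y ζ → X * (y * y) - (B * (1ℚ * 1ℚ * 1ℚ * 1ℚ) + (X * X * (ζ * ζ * ζ * ζ) - A * X * (1ℚ * 1ℚ) * (ζ * ζ)))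
        ≡ X * (y * y) - (B + (X * X * (ζ * ζ * ζ * ζ) - A * X * (ζ * ζ)))
      simplify = solve-∀ ℚ-ring
      scaled : residual X z w * (ζ * ζ * ζ * ζ) ≡ X * (y * y) - U
      scaled = begin
        residual X z w * (ζ * ζ * ζ * ζ)   ≡⟨ expand X A B z w ζ ⟩
        X * (y * y) - U[ z * ζ ]           ≡⟨ cong (λ t → X * (y * y) - U[ t ]) zζ≡1 ⟩
        X * (y * y) - U[ 1ℚ ]              ≡⟨ simplify X A B y ζ ⟩
        X * (y * y) - U                    ∎
        where open ≡-Reasoning

    no-point-mod-q³ : ∀ z w → ¬ Val≥ 3 (residual X z w)
    no-point-mod-q³ z w with Val≥0⊎inverse-Val≥1 z
    ... | inj₂ (ζ , zζ≡1 , ζ-divisible) = nonintegral-z z w ζ zζ≡1 ζ-divisible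
    ... | inj₁ z-integral with Val≥1? z
    ...   | yes z-divisible = divisible-z z w z-divisible
    ...   | no ¬z-divisible = unit-z z w (z-integral , ¬z-divisible)

    ¬LocalPoint : ¬ LocalPoint (fin q) X
    ¬LocalPoint (z , w , _ , _ , →0) = no-point-mod-q³ (z N) (w N) (Small⇒Val≥ {2} (proj₂ (→0 3) N ℕP.≤-refl))
      where
      N : ℕ
      N = proj₁ (→0 3)

  module QAdicLift (q : ℕ) (q-prime : Prime q) where
    open Valuation q q-prime

    Q : ℚ
    Q = ℕtoℚ q

    -- r converges to the root of r = s - q r², so u = 1 + 2 q r converges to √(1 + 4 q s).
    module SquareRoot {s : ℚ} (s-integral : Val≥ 0 s) where
      r : ℕ → ℚ
      r zero    = 0ℚ
      r (suc n) = s - Q * (r n * r n)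

      r-integral : ∀ n → Val≥ 0 (r n)
      r-integral zero    = Val≥-0ℚ 0
      r-integral (suc n) = Val≥-sub s-integral (Val≥-pred (Val≥-* Val≥-q (Val≥-* (r-integral n) (r-integral n))))

      r-step : ∀ n → Val≥ n (r (suc n) - r n)
      r-step zero    = Val≥-sub (r-integral 1) (r-integral 0)
      r-step (suc n) = subst (Val≥ (suc n)) (sym (difference Q s (r n) (r (suc n))))
        (Val≥-* (Val≥-* Val≥-q (Val≥-neg (Val≥-+ (r-integral (suc n)) (r-integral n)))) (r-step n))
        where
        difference : ∀ Q s a b → (s - Q * (b * b)) - (s - Q * (a * a)) ≡ Q * - (b + a) * (b - a)
        difference = solve-∀ ℚ-ring

      u : ℕ → ℚ
      u n = 1ℚ + 2 * Q * r n

      u²-error : ∀ n → u n * u n - (1ℚ + 4 * Q * s) ≡ 4 * Q * - (r (suc n) - r n)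
      u²-error n = expand Q s (r n)
        where
        expand : ∀ Q s a → (1ℚ + 2 * Q * a) * (1ℚ + 2 * Q * a) - (1ℚ + 4 * Q * s) ≡ 4 * Q * - ((s - Q * (a * a)) - a)
        expand = solve-∀ ℚ-ring

    LocalPoint-lift : ∀ j d z g s → Val≥ 0 d → Val≥ 0 (ℕtoℚ (q ^ j) * g) → Val≥ 0 s →
                      quartic d z ≡ d * (g * g) * (1ℚ + 4 * Q * s) →
                      LocalPoint (fin q) d
    LocalPoint-lift j d z g s d-integral G-integral s-integral on-curve =
      (λ _ → z) , w , Cauchy-const (fin q) z , w-Cauchy , residual→0
      where
      open SquareRoot s-integral
      J : ℚ
      J = ℕtoℚ (q ^ j)
      w : ℕ → ℚ
      w n = g * u n

      w-Cauchy : Cauchy (fin q) w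
      w-Cauchy k = j ℕ.+ k , λ m n N≤m N≤n → Val≥⇒Small (Val≥-cancelˡ-q^ j (subst (Val≥ (j ℕ.+ k)) (sym (scaled m n))
        (Val≥-pred (Val≥-* (Val≥-* (Val≥-* (Val≥-ℤtoℚ (+ 2)) Val≥-q) G-integral) (Val≥-telescope r r-step (j ℕ.+ k) m n N≤m N≤n)))))
        where
        expand : ∀ J g Q a b → J * (g * (1ℚ + 2 * Q * a) - g * (1ℚ + 2 * Q * b)) ≡ 2 * Q * (J * g) * (a - b)
        expand = solve-∀ ℚ-ring
        scaled : ∀ m n → J * (w m - w n) ≡ 2 * Q * (J * g) * (r m - r n)
        scaled m n = expand J g Q (r m) (r n)

      residual→0 : TendsToZero (fin q) (λ n → residual d z (w n))
      residual→0 k = j ℕ.+ (j ℕ.+ k) , λ n N≤n → Val≥⇒Small (Val≥-cancelˡ-q^ j (Val≥-cancelˡ-q^ j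
        (subst (Val≥ _) (sym (scaled n)) (Val≥-≤ (ℕP.m≤n⇒m≤1+n N≤n)
          (Val≥-* (Val≥-* d-integral (Val≥-* G-integral G-integral)) (Val≥-* (Val≥-* (Val≥-ℤtoℚ (+ 4)) Val≥-q) (Val≥-neg (r-step n))))))))
        where
        c : ℚ
        c = 1ℚ + 4 * Q * s
        expand : ∀ J d g u c → J * (J * (d * ((g * u) * (g * u)) - d * (g * g) * c)) ≡ d * ((J * g) * (J * g)) * (u * u - c)
        expand = solve-∀ ℚ-ring
        scaled : ∀ n → J * (J * residual d z (w n)) ≡ d * ((J * g) * (J * g)) * (4 * Q * - (r (suc n) - r n))
        scaled n = begin
          J * (J * residual d z (w n))                          ≡⟨ cong (λ t → J * (J * (d * (w n * w n) - t))) on-curve ⟩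
          J * (J * (d * (w n * w n) - d * (g * g) * c))         ≡⟨ expand J d g (u n) c ⟩
          d * ((J * g) * (J * g)) * (u n * u n - c)             ≡⟨ cong (d * ((J * g) * (J * g)) *_) (u²-error n) ⟩
          d * ((J * g) * (J * g)) * (4 * Q * - (r (suc n) - r n)) ∎
          where open ≡-Reasoning

module RootOfHalf where
  open import Data.Nat using (_+_; _*_; _∸_; _≤_; _<_; _≤?_)

  nextDigit : ℕ → ℕ → ℕ
  nextDigit a S with 2 * ((2 * a + 1) * (2 * a + 1)) ≤? S
  ... | yes _ = 2 * a + 1
  ... | no  _ = 2 * a

  nextDigit-cases : ∀ a S → (nextDigit a S ≡ 2 * a + 1 × 2 * ((2 * a + 1) * (2 * a + 1)) ≤ S)
                          ⊎ (nextDigit a S ≡ 2 * a × S < 2 * ((2 * a + 1) * (2 * a + 1)))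
  nextDigit-cases a S with 2 * ((2 * a + 1) * (2 * a + 1)) ≤? S
  ... | yes fits = inj₁ (refl , fits)
  ... | no ¬fits = inj₂ (refl , ℕP.≰⇒> ¬fits)

  -- root½ n = ⌊2ⁿ/√2⌋, computed one binary digit at a time.
  root½ : ℕ → ℕ
  root½ zero    = 0
  root½ (suc n) = nextDigit (root½ n) (2 ^ suc n * 2 ^ suc n)

  double² : ∀ T → 2 * T * (2 * T) ≡ 4 * (T * T)
  double² = solve-∀ ℕ-ring

  twice-succ : ∀ x → 2 * (x + 1) ≡ 2 * x + 1 + 1
  twice-succ = solve-∀ ℕ-ring

  double-root² : ∀ a → 2 * (2 * a * (2 * a)) ≡ 4 * (2 * (a * a))
  double-root² = solve-∀ ℕ-ring

  double-succ² : ∀ a → 2 * ((2 * a + 1 + 1) * (2 * a + 1 + 1)) ≡ 4 * (2 * ((a + 1) * (a + 1)))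
  double-succ² = solve-∀ ℕ-ring

  root½-bounds : ∀ n → 2 * (root½ n * root½ n) ≤ 2 ^ n * 2 ^ n × 2 ^ n * 2 ^ n < 2 * ((root½ n + 1) * (root½ n + 1))
  root½-bounds zero = z≤n , s≤s (s≤s z≤n)
  root½-bounds (suc n) with nextDigit-cases (root½ n) (2 ^ suc n * 2 ^ suc n) | root½-bounds n
  ... | inj₁ (next≡ , fits) | _ , upper rewrite next≡ =
    fits , subst₂ _<_ (sym (double² (2 ^ n))) (sym (double-succ² (root½ n))) (ℕP.*-monoʳ-< 4 upper)
  ... | inj₂ (next≡ , ¬fits) | lower , _ rewrite next≡ =
    subst₂ _≤_ (sym (double-root² (root½ n))) (sym (double² (2 ^ n))) (ℕP.*-monoʳ-≤ 4 lower) , ¬fits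

  root½-next : ∀ n → root½ (suc n) ≡ 2 * root½ n ⊎ root½ (suc n) ≡ 2 * root½ n + 1
  root½-next n with nextDigit-cases (root½ n) (2 ^ suc n * 2 ^ suc n)
  ... | inj₁ (next≡ , _) = inj₂ next≡
  ... | inj₂ (next≡ , _) = inj₁ next≡

  doubling : ∀ {L U x x′} → L ≤ x → x + 1 ≤ U → x′ ≡ 2 * x ⊎ x′ ≡ 2 * x + 1 → 2 * L ≤ x′ × x′ + 1 ≤ 2 * U
  doubling {U = U} {x} L≤x x<U (inj₁ refl) =
    ℕP.*-monoʳ-≤ 2 L≤x , ℕP.≤-trans (ℕP.m≤m+n (2 * x + 1) 1) (subst (_≤ 2 * U) (twice-succ x) (ℕP.*-monoʳ-≤ 2 x<U))
  doubling {U = U} {x} L≤x x<U (inj₂ refl) =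
    ℕP.≤-trans (ℕP.*-monoʳ-≤ 2 L≤x) (ℕP.m≤m+n (2 * x) 1) , subst (_≤ 2 * U) (twice-succ x) (ℕP.*-monoʳ-≤ 2 x<U)

  root½-shift : ∀ i n → 2 ^ i * root½ n ≤ root½ (i + n) × root½ (i + n) + 1 ≤ 2 ^ i * (root½ n + 1)
  root½-shift zero    n = ℕP.≤-reflexive (ℕP.*-identityˡ (root½ n)) , ℕP.≤-reflexive (sym (ℕP.*-identityˡ (root½ n + 1)))
  root½-shift (suc i) n = subst (_≤ root½ (suc i + n)) (sym (ℕP.*-assoc 2 (2 ^ i) (root½ n))) (proj₁ doubled)
                        , subst (root½ (suc i + n) + 1 ≤_) (sym (ℕP.*-assoc 2 (2 ^ i) (root½ n + 1))) (proj₂ doubled)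
    where
    doubled : 2 * (2 ^ i * root½ n) ≤ root½ (suc i + n) × root½ (suc i + n) + 1 ≤ 2 * (2 ^ i * (root½ n + 1))
    doubled = doubling (proj₁ (root½-shift i n)) (proj₂ (root½-shift i n)) (root½-next (i + n))

  n<2^n : ∀ n → n < 2 ^ n
  n<2^n zero    = s≤s z≤n
  n<2^n (suc n) = subst (suc (suc n) ≤_) (cong (λ t → 2 ^ n + t) (sym (ℕP.+-identityʳ (2 ^ n)))) (ℕP.+-mono-≤ (ℕP.m^n>0 2 n) (n<2^n n))

  module _ (n : ℕ) where
    private
      T a : ℕ
      T = 2 ^ n
      a = root½ n

    root½≤2^n : a ≤ T
    root½≤2^n with a ℕ.≤? T
    ... | yes a≤T = a≤T
    ... | no  a≰T = ⊥-elim (ℕP.<⇒≱ (ℕP.<-≤-trans (ℕP.*-mono-< T<a T<a) (ℕP.m≤m+n (a * a) (a * a + 0))) (proj₁ (root½-bounds n)))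
      where
      T<a : T < a
      T<a = ℕP.≰⇒> a≰T

    defect : ℕ
    defect = T * T ∸ 2 * (a * a)

    defect+ : defect + 2 * (a * a) ≡ T * T
    defect+ = ℕP.m∸n+n≡m (proj₁ (root½-bounds n))

    defect≤5*2^n : defect ≤ 5 * T
    defect≤5*2^n = begin
      defect      ≤⟨ ℕP.+-cancelʳ-≤ (2 * (a * a)) defect (4 * a + 1) (ℕP.≤-pred (subst₂ _<_ (sym defect+) (expand a) (proj₂ (root½-bounds n)))) ⟩
      4 * a + 1   ≤⟨ ℕP.+-mono-≤ (ℕP.*-monoʳ-≤ 4 root½≤2^n) (ℕP.m^n>0 2 n) ⟩
      4 * T + T   ≡⟨ ℕP.+-comm (4 * T) T ⟩
      5 * T       ∎
      where
      open ℕP.≤-Reasoning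
      expand : ∀ a → 2 * ((a + 1) * (a + 1)) ≡ suc (4 * a + 1 + 2 * (a * a))
      expand = solve-∀ ℕ-ring

    module _ (p : ℕ) (2≤p : 2 ≤ p) where

      4*root½²≤p*4ⁿ : 4 * (a * a) ≤ p * (T * T)
      4*root½²≤p*4ⁿ = ℕP.≤-trans (ℕP.≤-reflexive (ℕP.*-assoc 2 2 (a * a))) (ℕP.*-mono-≤ 2≤p (proj₁ (root½-bounds n)))

      defectₚ : ℕ
      defectₚ = p * (T * T) ∸ 4 * (a * a)

      defects-small : ∀ k → 20 * p * p * suc k ≤ n → 4 * p * defect * defectₚ * suc k ≤ T * T * T * T
      defects-small k 20p²[k+1]≤n = begin
        4 * p * defect * defectₚ * suc k             ≤⟨ ℕP.*-monoˡ-≤ (suc k)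
                                                          (ℕP.*-mono-≤ (ℕP.*-monoʳ-≤ (4 * p) defect≤5*2^n) (ℕP.m∸n≤m (p * (T * T)) (4 * (a * a)))) ⟩
        4 * p * (5 * T) * (p * (T * T)) * suc k      ≡⟨ regroup p k T ⟩
        (20 * p * p * suc k) * (T * T * T)           ≤⟨ ℕP.*-monoˡ-≤ (T * T * T) (ℕP.≤-trans 20p²[k+1]≤n (ℕP.<⇒≤ (n<2^n n))) ⟩
        T * (T * T * T)                              ≡⟨ ℕP.*-comm T (T * T * T) ⟩
        T * T * T * T ∎
        where
        open ℕP.≤-Reasoning
        regroup : ∀ p k T → 4 * p * (5 * T) * (p * (T * T)) * suc k ≡ (20 * p * p * suc k) * (T * T * T)
        regroup = solve-∀ ℕ-ring

module RealApproximation where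
  open import Data.Rational using (_+_; _*_; _-_; -_)
  open Embedding
  open RootOfHalf
  open Places

  Small-∞-scaled : ∀ k x (A : ℤ) (B : ℕ) .{{_ : ℕ.NonZero B}} → x * ℕtoℚ B ≡ ℤtoℚ A → ℤ.∣ A ∣ ℕ.* suc k ℕ.≤ B → Small ∞ k x
  Small-∞-scaled k x@(mkℚ n d _) A B x*B≡A |A|[k+1]≤B =
    ℚP.toℚᵘ-cancel-≤ (ℚᵘP.≤-respʳ-≃ (ℚᵘP.≃-sym (ℚP.toℚᵘ-fromℚᵘ (mkℚᵘ (+ 1) k)))
      (ℚᵘ.*≤* (subst₂ ℤ._≤_ (ℤP.pos-* ℤ.∣ n ∣ (suc k)) (sym (ℤP.*-identityˡ (+ suc d))) (ℤ.+≤+ |n|[k+1]≤d+1))))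
    where
    |n|*B≡|A|*[d+1] : ℤ.∣ n ∣ ℕ.* B ≡ ℤ.∣ A ∣ ℕ.* suc d
    |n|*B≡|A|*[d+1] = trans (sym (ℤP.abs-* n (+ B))) (trans (cong ℤ.∣_∣ (cross-multiply x (+ B) A x*B≡A)) (ℤP.abs-* A (+ suc d)))
    swap : ∀ a b c → a ℕ.* b ℕ.* c ≡ a ℕ.* c ℕ.* b
    swap = solve-∀ ℕ-ring
    |n|[k+1]≤d+1 : ℤ.∣ n ∣ ℕ.* suc k ℕ.≤ suc d
    |n|[k+1]≤d+1 = ℕP.*-cancelʳ-≤ _ _ B (begin
      ℤ.∣ n ∣ ℕ.* suc k ℕ.* B      ≡⟨ swap ℤ.∣ n ∣ (suc k) B ⟩
      ℤ.∣ n ∣ ℕ.* B ℕ.* suc k      ≡⟨ cong (ℕ._* suc k) |n|*B≡|A|*[d+1] ⟩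
      ℤ.∣ A ∣ ℕ.* suc d ℕ.* suc k  ≡⟨ swap ℤ.∣ A ∣ (suc d) (suc k) ⟩
      ℤ.∣ A ∣ ℕ.* suc k ℕ.* suc d  ≤⟨ ℕP.*-monoˡ-≤ (suc d) |A|[k+1]≤B ⟩
      B ℕ.* suc d                  ≡⟨ ℕP.*-comm B (suc d) ⟩
      suc d ℕ.* B                  ∎)
      where open ℕP.≤-Reasoning

  half^ : ℕ → ℚ
  half^ zero    = 1ℚ
  half^ (suc n) = half^ n * (+ 1 / 2)

  half^*2^ : ∀ n → half^ n * ℕtoℚ (2 ^ n) ≡ 1ℚ
  half^*2^ zero    = refl
  half^*2^ (suc n) = begin
    half^ n * (+ 1 / 2) * ℕtoℚ (2 ℕ.* 2 ^ n)     ≡⟨ cong (half^ n * (+ 1 / 2) *_) (ℕtoℚ-* 2 (2 ^ n)) ⟩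
    half^ n * (+ 1 / 2) * (2 * ℕtoℚ (2 ^ n))     ≡⟨ regroup (half^ n) (ℕtoℚ (2 ^ n)) ⟩
    half^ n * ℕtoℚ (2 ^ n)                       ≡⟨ half^*2^ n ⟩
    1ℚ                                           ∎
    where
    open ≡-Reasoning
    regroup : ∀ h t → h * (+ 1 / 2) * (2 * t) ≡ h * t
    regroup = solve-∀ ℚ-ring

  approx : ℕ → ℚ
  approx n = ℕtoℚ (root½ n) * half^ n

  approx*2^ : ∀ n → approx n * ℕtoℚ (2 ^ n) ≡ ℕtoℚ (root½ n)
  approx*2^ n = trans (ℚP.*-assoc (ℕtoℚ (root½ n)) (half^ n) _) (trans (cong (ℕtoℚ (root½ n) *_) (half^*2^ n)) (ℚP.*-identityʳ _))

  approx-close : ∀ k i n → k ℕ.≤ n → Small ∞ k (approx (i ℕ.+ n) - approx n)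
  approx-close k i n k≤n = Small-∞-scaled k _ (+ (a′ ℕ.∸ L)) (2 ^ (i ℕ.+ n)) {{ℕP.m^n≢0 2 (i ℕ.+ n)}} scaled bound
    where
    open ≡-Reasoning
    a′ L : ℕ
    a′ = root½ (i ℕ.+ n)
    L = 2 ^ i ℕ.* root½ n
    a′≤L+2^i : a′ ℕ.≤ L ℕ.+ 2 ^ i
    a′≤L+2^i = ℕP.≤-trans (ℕP.m≤m+n a′ 1) (ℕP.≤-trans (proj₂ (root½-shift i n))
                 (ℕP.≤-reflexive (trans (ℕP.*-distribˡ-+ (2 ^ i) (root½ n) 1) (cong (L ℕ.+_) (ℕP.*-identityʳ (2 ^ i))))))
    bound : (a′ ℕ.∸ L) ℕ.* suc k ℕ.≤ 2 ^ (i ℕ.+ n)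
    bound = ℕP.≤-trans (ℕP.*-mono-≤ (ℕP.≤-trans (ℕP.∸-monoˡ-≤ L a′≤L+2^i) (ℕP.≤-reflexive (ℕP.m+n∸m≡n L (2 ^ i))))
                                    (ℕP.≤-trans (s≤s k≤n) (n<2^n n)))
                       (ℕP.≤-reflexive (sym (ℕP.^-distribˡ-+-* 2 i n)))
    swap : ∀ x t u → x * (t * u) ≡ t * (x * u)
    swap = solve-∀ ℚ-ring
    distrib : ∀ x y M → (x - y) * M ≡ x * M - y * M
    distrib = solve-∀ ℚ-ring
    approx-n*2^[i+n] : approx n * ℕtoℚ (2 ^ (i ℕ.+ n)) ≡ ℕtoℚ L
    approx-n*2^[i+n] = begin
      approx n * ℕtoℚ (2 ^ (i ℕ.+ n))              ≡⟨ cong (approx n *_) (trans (cong ℕtoℚ (ℕP.^-distribˡ-+-* 2 i n)) (ℕtoℚ-* (2 ^ i) (2 ^ n))) ⟩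
      approx n * (ℕtoℚ (2 ^ i) * ℕtoℚ (2 ^ n))     ≡⟨ swap (approx n) (ℕtoℚ (2 ^ i)) (ℕtoℚ (2 ^ n)) ⟩
      ℕtoℚ (2 ^ i) * (approx n * ℕtoℚ (2 ^ n))     ≡⟨ cong (ℕtoℚ (2 ^ i) *_) (approx*2^ n) ⟩
      ℕtoℚ (2 ^ i) * ℕtoℚ (root½ n)                 ≡⟨ ℕtoℚ-* (2 ^ i) (root½ n) ⟨
      ℕtoℚ L                                       ∎
    scaled : (approx (i ℕ.+ n) - approx n) * ℕtoℚ (2 ^ (i ℕ.+ n)) ≡ ℕtoℚ (a′ ℕ.∸ L)
    scaled = begin
      (approx (i ℕ.+ n) - approx n) * ℕtoℚ (2 ^ (i ℕ.+ n))                         ≡⟨ distrib (approx (i ℕ.+ n)) (approx n) _ ⟩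
      approx (i ℕ.+ n) * ℕtoℚ (2 ^ (i ℕ.+ n)) - approx n * ℕtoℚ (2 ^ (i ℕ.+ n))    ≡⟨ cong₂ _-_ (approx*2^ (i ℕ.+ n)) approx-n*2^[i+n] ⟩
      ℕtoℚ a′ - ℕtoℚ L                                                             ≡⟨ ℕtoℚ-∸ (proj₁ (root½-shift i n)) ⟨
      ℕtoℚ (a′ ℕ.∸ L)                                                              ∎

  approx-Cauchy : Cauchy ∞ approx
  approx-Cauchy k = k , close
    where
    flip : ∀ x y → - (y - x) ≡ x - y
    flip = solve-∀ ℚ-ring
    close : ∀ m n → k ℕ.≤ m → k ℕ.≤ n → Small ∞ k (approx m - approx n)
    close m n k≤m k≤n with ℕP.≤-total n m
    ... | inj₁ n≤m = subst (λ t → Small ∞ k (approx t - approx n)) (ℕP.m∸n+n≡m n≤m) (approx-close k (m ℕ.∸ n) n k≤n)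
    ... | inj₂ m≤n = subst (Small ∞ k) (flip (approx m) (approx n))
      (subst (ℚ._≤ + 1 / suc k) (sym (ℚP.∣-p∣≡∣p∣ (approx n - approx m)))
        (subst (λ t → Small ∞ k (approx t - approx m)) (ℕP.m∸n+n≡m m≤n) (approx-close k (n ℕ.∸ m) m k≤m)))

  module _ (p : ℕ) (2≤p : 2 ℕ.≤ p) where
    open Quartic (ℕtoℚ (4 ℕ.* (p ℕ.+ 2))) (ℕtoℚ (32 ℕ.* p)) using (residual; LocalPoint)

    P : ℚ
    P = ℕtoℚ p

    16ⁿ : ℕ → ℕ
    16ⁿ n = 2 ^ n ℕ.* 2 ^ n ℕ.* 2 ^ n ℕ.* 2 ^ n

    defect-product : ℕ → ℕ
    defect-product n = 4 ℕ.* p ℕ.* defect n ℕ.* defectₚ n p 2≤p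

    -- With w = 0 the quartic factors as -4p (1 - 2z²)(p - 4z²).
    residual-at-approx : ∀ n → residual (ℕtoℚ (2 ℕ.* p)) (approx n) 0ℚ * ℕtoℚ (16ⁿ n) ≡ ℤtoℚ (ℤ.- + defect-product n)
    residual-at-approx n = begin
      residual (ℕtoℚ (2 ℕ.* p)) z 0ℚ * ℕtoℚ (16ⁿ n)
        ≡⟨ cong₂ _*_ (trans (cong₂ (λ d A → R d A (ℕtoℚ (32 ℕ.* p))) (ℕtoℚ-* 2 p) A≡)
                            (cong (R (2 * P) (4 * (P + 2))) (ℕtoℚ-* 32 p))) 16ⁿ≡ ⟩
      R (2 * P) (4 * (P + 2)) (32 * P) * (T * T * T * T)
        ≡⟨ factor P z T ⟩
      - (4 * P * (T * T - 2 * ((z * T) * (z * T))) * (P * (T * T) - 4 * ((z * T) * (z * T))))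
        ≡⟨ cong (λ t → - (4 * P * (T * T - 2 * (t * t)) * (P * (T * T) - 4 * (t * t)))) (approx*2^ n) ⟩
      - (4 * P * (T * T - 2 * (a * a)) * (P * (T * T) - 4 * (a * a)))
        ≡⟨ cong₂ (λ E F → - (4 * P * E * F)) E≡ F≡ ⟨
      - (4 * P * ℕtoℚ (defect n) * ℕtoℚ (defectₚ n p 2≤p))
        ≡⟨ cong -_ (trans (ℕtoℚ-* (4 ℕ.* p ℕ.* defect n) (defectₚ n p 2≤p))
                     (cong (_* ℕtoℚ (defectₚ n p 2≤p)) (trans (ℕtoℚ-* (4 ℕ.* p) (defect n)) (cong (_* ℕtoℚ (defect n)) (ℕtoℚ-* 4 p))))) ⟨
      - ℕtoℚ (defect-product n)
        ≡⟨ ℤtoℚ-neg (+ defect-product n) ⟨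
      ℤtoℚ (ℤ.- + defect-product n) ∎
      where
      open ≡-Reasoning
      z T a : ℚ
      z = approx n
      T = ℕtoℚ (2 ^ n)
      a = ℕtoℚ (root½ n)
      R : ℚ → ℚ → ℚ → ℚ
      R d A B = d * (0ℚ * 0ℚ) - ((d * d - A * d * (z * z)) + B * (z * z * z * z))
      A≡ : ℕtoℚ (4 ℕ.* (p ℕ.+ 2)) ≡ 4 * (P + 2)
      A≡ = trans (ℕtoℚ-* 4 (p ℕ.+ 2)) (cong (4 *_) (ℕtoℚ-+ p 2))
      16ⁿ≡ : ℕtoℚ (16ⁿ n) ≡ T * T * T * T
      16ⁿ≡ = trans (ℕtoℚ-* (2 ^ n ℕ.* 2 ^ n ℕ.* 2 ^ n) (2 ^ n))
               (cong (_* T) (trans (ℕtoℚ-* (2 ^ n ℕ.* 2 ^ n) (2 ^ n)) (cong (_* T) (ℕtoℚ-* (2 ^ n) (2 ^ n)))))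
      c*a²≡ : ∀ c → ℕtoℚ (c ℕ.* (root½ n ℕ.* root½ n)) ≡ ℕtoℚ c * (a * a)
      c*a²≡ c = trans (ℕtoℚ-* c (root½ n ℕ.* root½ n)) (cong (ℕtoℚ c *_) (ℕtoℚ-* (root½ n) (root½ n)))
      E≡ : ℕtoℚ (defect n) ≡ T * T - 2 * (a * a)
      E≡ = trans (ℕtoℚ-∸ (proj₁ (root½-bounds n))) (cong₂ _-_ (ℕtoℚ-* (2 ^ n) (2 ^ n)) (c*a²≡ 2))
      F≡ : ℕtoℚ (defectₚ n p 2≤p) ≡ P * (T * T) - 4 * (a * a)
      F≡ = trans (ℕtoℚ-∸ (4*root½²≤p*4ⁿ n p 2≤p))
             (cong₂ _-_ (trans (ℕtoℚ-* p (2 ^ n ℕ.* 2 ^ n)) (cong (P *_) (ℕtoℚ-* (2 ^ n) (2 ^ n)))) (c*a²≡ 4))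
      factor : ∀ P z T → (2 * P * (0ℚ * 0ℚ) - ((2 * P * (2 * P) - 4 * (P + 2) * (2 * P) * (z * z)) + 32 * P * (z * z * z * z)))
                           * (T * T * T * T)
                         ≡ - (4 * P * (T * T - 2 * ((z * T) * (z * T))) * (P * (T * T) - 4 * ((z * T) * (z * T))))
      factor = solve-∀ ℚ-ring

    LocalPoint-∞ : LocalPoint ∞ (ℕtoℚ (2 ℕ.* p))
    LocalPoint-∞ = approx , (λ _ → 0ℚ) , approx-Cauchy , Cauchy-const ∞ 0ℚ , residual→0
      where
      16ⁿ≢0 : ∀ n → ℕ.NonZero (16ⁿ n)
      16ⁿ≢0 n = ℕP.m*n≢0 _ _ {{ℕP.m*n≢0 _ _ {{ℕP.m*n≢0 _ _ {{ℕP.m^n≢0 2 n}} {{ℕP.m^n≢0 2 n}}}} {{ℕP.m^n≢0 2 n}}}} {{ℕP.m^n≢0 2 n}}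
      residual→0 : TendsToZero ∞ (λ n → residual (ℕtoℚ (2 ℕ.* p)) (approx n) 0ℚ)
      residual→0 k = 20 ℕ.* p ℕ.* p ℕ.* suc k , λ n N≤n →
        Small-∞-scaled k _ (ℤ.- + defect-product n) (16ⁿ n) {{16ⁿ≢0 n}} (residual-at-approx n)
          (subst (λ t → t ℕ.* suc k ℕ.≤ 16ⁿ n) (sym (ℤP.∣-i∣≡∣i∣ (+ defect-product n))) (defects-small n p 2≤p k N≤n))

module SelmerGroup (p : ℕ) (p-prime : Prime p) (q-prime : Prime (p ℕ.∸ 2)) (p≡5[8] : p ℕ.% 8 ≡ 5) where
  open import Data.Rational using (_+_; _*_; _-_; -_; _≤_)
  open Embedding
  open Quartic (ℕtoℚ (4 ℕ.* (p ℕ.+ 2))) (ℕtoℚ (32 ℕ.* p))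

  q : ℕ
  q = p ℕ.∸ 2

  P Q : ℚ
  P = ℕtoℚ p
  Q = ℕtoℚ q

  5≤p : 5 ℕ.≤ p
  5≤p = ≡5[8]⇒5≤ p p≡5[8]
    where
    ≡5[8]⇒5≤ : ∀ n → n ℕ.% 8 ≡ 5 → 5 ℕ.≤ n
    ≡5[8]⇒5≤ (suc (suc (suc (suc (suc _))))) _ = s≤s (s≤s (s≤s (s≤s (s≤s z≤n))))

  2≤p : 2 ℕ.≤ p
  2≤p = ℕP.≤-trans (ℕP.m≤m+n 2 3) 5≤p

  3≤q : 3 ℕ.≤ q
  3≤q = ℕP.∸-monoˡ-≤ 2 5≤p

  p≡q+2 : P ≡ Q + 2
  p≡q+2 = trans (cong ℕtoℚ (sym (ℕP.m∸n+n≡m 2≤p))) (ℕtoℚ-+ q 2)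

  instance
    p≢0 : ℕ.NonZero p
    p≢0 = prime⇒nonZero p-prime
    q≢0 : ℕ.NonZero q
    q≢0 = prime⇒nonZero q-prime

  A≡ : ℕtoℚ (4 ℕ.* (p ℕ.+ 2)) ≡ 4 * (P + 2)
  A≡ = trans (ℕtoℚ-* 4 (p ℕ.+ 2)) (cong (4 *_) (ℕtoℚ-+ p 2))

  B≡ : ℕtoℚ (32 ℕ.* p) ≡ 32 * P
  B≡ = ℕtoℚ-* 32 p

  quarticₚ : ℚ → ℚ → ℚ
  quarticₚ d z = (d * d - 4 * (P + 2) * d * (z * z)) + 32 * P * (z * z * z * z)

  quartic≡quarticₚ : ∀ d z → quartic d z ≡ quarticₚ d z
  quartic≡quarticₚ d z = cong₂ (λ A B → (d * d - A * d * (z * z)) + B * (z * z * z * z)) A≡ B≡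

  on-curve : ∀ d z w → d * (w * w) - quarticₚ d z ≡ 0ℚ → residual d z w ≡ 0ℚ
  on-curve d z w = trans (cong (λ t → d * (w * w) - t) (quartic≡quarticₚ d z))

  everywhere : ∀ d → (∀ {v} → LocalPoint v (ℤtoℚ d)) → InSelmer p d
  everywhere d point = point ∷ point ∷ point ∷ point ∷ []

  InSelmer-1 : InSelmer p (+ 1)
  InSelmer-1 = everywhere (+ 1) (rational-point 1ℚ 0ℚ 1ℚ (on-curve 1ℚ 0ℚ 1ℚ (lies-on-curve P)))
    where
    lies-on-curve : ∀ P → 1ℚ * (1ℚ * 1ℚ) - ((1ℚ * 1ℚ - 4 * (P + 2) * 1ℚ * (0ℚ * 0ℚ)) + 32 * P * (0ℚ * 0ℚ * 0ℚ * 0ℚ)) ≡ 0ℚ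
    lies-on-curve = solve-∀ ℚ-ring

  InSelmer-2 : InSelmer p (+ 2)
  InSelmer-2 = everywhere (+ 2) (rational-point 2 (+ 1 / 2) 0ℚ (on-curve 2 (+ 1 / 2) 0ℚ (lies-on-curve P)))
    where
    lies-on-curve : ∀ P → 2 * (0ℚ * 0ℚ) - ((2 * 2 - 4 * (P + 2) * 2 * (+ 1 / 2 * (+ 1 / 2))) + 32 * P * (+ 1 / 2 * (+ 1 / 2) * (+ 1 / 2) * (+ 1 / 2))) ≡ 0ℚ
    lies-on-curve = solve-∀ ℚ-ring

  InSelmer-p : InSelmer p (+ p)
  InSelmer-p = everywhere (+ p) (rational-point P (+ 1 / 2) 0ℚ (on-curve P (+ 1 / 2) 0ℚ (lies-on-curve P)))
    where
    lies-on-curve : ∀ P → P * (0ℚ * 0ℚ) - ((P * P - 4 * (P + 2) * P * (+ 1 / 2 * (+ 1 / 2))) + 32 * P * (+ 1 / 2 * (+ 1 / 2) * (+ 1 / 2) * (+ 1 / 2))) ≡ 0ℚ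
    lies-on-curve = solve-∀ ℚ-ring

  lift-equation : ∀ z g c → quarticₚ (2 * P) z ≡ 2 * P * (g * g) * c → quartic (ℕtoℚ (2 ℕ.* p)) z ≡ ℕtoℚ (2 ℕ.* p) * (g * g) * c
  lift-equation z g c eq = begin
    quartic (ℕtoℚ (2 ℕ.* p)) z        ≡⟨ quartic≡quarticₚ (ℕtoℚ (2 ℕ.* p)) z ⟩
    quarticₚ (ℕtoℚ (2 ℕ.* p)) z       ≡⟨ cong (λ d → quarticₚ d z) 2p≡ ⟩
    quarticₚ (2 * P) z                ≡⟨ eq ⟩
    2 * P * (g * g) * c               ≡⟨ cong (λ d → d * (g * g) * c) 2p≡ ⟨
    ℕtoℚ (2 ℕ.* p) * (g * g) * c      ∎
    where
    open ≡-Reasoning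
    2p≡ : ℕtoℚ (2 ℕ.* p) ≡ 2 * P
    2p≡ = ℕtoℚ-* 2 p

  p∤2 : ¬ p ∣ 2
  p∤2 = ℕP.<⇒≱ (ℕP.≤-trans (s≤s (s≤s (s≤s z≤n))) 5≤p) ∘ ∣⇒≤

  p∤3 : ¬ p ∣ 3
  p∤3 = ℕP.<⇒≱ (ℕP.≤-trans (s≤s (s≤s (s≤s (s≤s z≤n)))) 5≤p) ∘ ∣⇒≤

  q∤2 : ¬ q ∣ 2
  q∤2 = ℕP.<⇒≱ 3≤q ∘ ∣⇒≤

  q∤p : ¬ q ∣ p
  q∤p q∣p = q∤2 (∣m+n∣m⇒∣n (subst (q ∣_) (sym (ℕP.m∸n+n≡m 2≤p)) q∣p) ∣-refl)

  InSelmer-2p : InSelmer p (+ (2 ℕ.* p))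
  InSelmer-2p = RealApproximation.LocalPoint-∞ p 2≤p ∷ at-2 ∷ at-p ∷ at-q ∷ []
    where
    at-2 : LocalPoint (fin 2) (ℕtoℚ (2 ℕ.* p))
    at-2 = QAdicLift.LocalPoint-lift 2 prime[2] 4 (ℕtoℚ (2 ℕ.* p)) (+ 1 / 8) (+ 1 / 16) (62 * P - 4)
      (V₂.Val≥-ℤtoℚ (+ (2 ℕ.* p))) (V₂.Val≥-ℤtoℚ (+ 1))
      (V₂.Val≥-sub (V₂.Val≥-* (V₂.Val≥-ℤtoℚ (+ 62)) (V₂.Val≥-ℤtoℚ (+ p))) (V₂.Val≥-ℤtoℚ (+ 4)))
      (lift-equation (+ 1 / 8) (+ 1 / 16) _ (factorisation P))
      where
      module V₂ = Valuation 2 prime[2]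
      factorisation : ∀ P → (2 * P * (2 * P) - 4 * (P + 2) * (2 * P) * (+ 1 / 8 * (+ 1 / 8))) + 32 * P * (+ 1 / 8 * (+ 1 / 8) * (+ 1 / 8) * (+ 1 / 8))
                       ≡ 2 * P * (+ 1 / 16 * (+ 1 / 16)) * (1ℚ + 4 * 2 * (62 * P - 4))
      factorisation = solve-∀ ℚ-ring
    at-p : LocalPoint (fin p) (ℕtoℚ (2 ℕ.* p))
    at-p = QAdicLift.LocalPoint-lift p p-prime 0 (ℕtoℚ (2 ℕ.* p)) (+ 3 / 4) (+ 3 / 4) (-[1+ 0 ] / 9)
      (Vₚ.Val≥-ℤtoℚ (+ (2 ℕ.* p))) (Vₚ.Val≥-fraction {a = + 3} {b = + 4} refl (Vₚ.q∤^ p∤2 2))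
      (Vₚ.Val≥-fraction {a = -[1+ 0 ]} {b = + 9} refl (Vₚ.q∤^ p∤3 2))
      (lift-equation (+ 3 / 4) (+ 3 / 4) _ (factorisation P))
      where
      module Vₚ = Valuation p p-prime
      factorisation : ∀ P → (2 * P * (2 * P) - 4 * (P + 2) * (2 * P) * (+ 3 / 4 * (+ 3 / 4))) + 32 * P * (+ 3 / 4 * (+ 3 / 4) * (+ 3 / 4) * (+ 3 / 4))
                       ≡ 2 * P * (+ 3 / 4 * (+ 3 / 4)) * (1ℚ + 4 * P * (-[1+ 0 ] / 9))
      factorisation = solve-∀ ℚ-ring
    at-q : LocalPoint (fin q) (ℕtoℚ (2 ℕ.* p))
    at-q = QAdicLift.LocalPoint-lift q q-prime 0 (ℕtoℚ (2 ℕ.* p)) 0ℚ 2 (+ 1 / 8)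
      (V_q.Val≥-ℤtoℚ (+ (2 ℕ.* p))) (V_q.Val≥-ℤtoℚ (+ 2))
      (V_q.Val≥-fraction {a = + 1} {b = + 8} refl (V_q.q∤^ q∤2 3))
      (lift-equation 0ℚ 2 _ (subst (λ P → (2 * P * (2 * P) - 4 * (P + 2) * (2 * P) * (0ℚ * 0ℚ)) + 32 * P * (0ℚ * 0ℚ * 0ℚ * 0ℚ)
                                          ≡ 2 * P * (2 * 2) * (1ℚ + 4 * Q * (+ 1 / 8))) (sym p≡q+2) (factorisation Q)))
      where
      module V_q = Valuation q q-prime
      factorisation : ∀ Q → (2 * (Q + 2) * (2 * (Q + 2)) - 4 * (Q + 2 + 2) * (2 * (Q + 2)) * (0ℚ * 0ℚ)) + 32 * (Q + 2) * (0ℚ * 0ℚ * 0ℚ * 0ℚ)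
                       ≡ 2 * (Q + 2) * (2 * 2) * (1ℚ + 4 * Q * (+ 1 / 8))
      factorisation = solve-∀ ℚ-ring

  ¬InSelmer-negative : ∀ a b c → ¬ InSelmer p (rep p true a b c)
  ¬InSelmer-negative a b c (at-∞ ∷ _) =
    ¬LocalPoint-∞ {{ℚP.normalize-nonNeg (4 ℕ.* (p ℕ.+ 2)) 1}} {{ℚP.normalize-nonNeg (32 ℕ.* p) 1}}
      (1≤ℕtoℚ 1≤M) (subst (LocalPoint ∞) rep≡ at-∞)
    where
    M : ℕ
    M = 2 ^ bit a ℕ.* p ^ bit b ℕ.* q ^ bit c
    1≤M : 1 ℕ.≤ M
    1≤M = ℕP.*-mono-≤ (ℕP.*-mono-≤ (ℕP.m^n>0 2 (bit a)) (ℕP.m^n>0 p (bit b))) (ℕP.m^n>0 q (bit c))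
    rep≡ : ℤtoℚ (rep p true a b c) ≡ - ℕtoℚ M
    rep≡ = trans (cong ℤtoℚ (ℤP.-1*i≡-i (+ M))) (ℤtoℚ-neg (+ M))

  ¬InSelmer-q : ∀ a b → ¬ InSelmer p (rep p false a b true)
  ¬InSelmer-q a b (_ ∷ _ ∷ _ ∷ at-q ∷ []) =
    QAdicObstruction.¬LocalPoint q q-prime (Unit-ℤtoℚ (+ e) (q∤* (q∤^ q∤2 (bit a)) (q∤^ q∤p (bit b))))
      (Val≥-ℤtoℚ (+ (4 ℕ.* (p ℕ.+ 2)))) (Unit-ℤtoℚ (+ (32 ℕ.* p)) (q∤* (q∤^ q∤2 5) q∤p))
      (subst (LocalPoint (fin q)) rep≡ at-q)
    where
    open Valuation q q-prime
    e : ℕ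
    e = 2 ^ bit a ℕ.* p ^ bit b
    rep≡ : ℤtoℚ (rep p false a b true) ≡ Q * ℕtoℚ e
    rep≡ = begin
      ℤtoℚ (+ 1 ℤ.* + (e ℕ.* (q ℕ.* 1)))   ≡⟨ cong ℤtoℚ (ℤP.*-identityˡ (+ (e ℕ.* (q ℕ.* 1)))) ⟩
      ℕtoℚ (e ℕ.* (q ℕ.* 1))               ≡⟨ cong (λ t → ℕtoℚ (e ℕ.* t)) (ℕP.*-identityʳ q) ⟩
      ℕtoℚ (e ℕ.* q)                       ≡⟨ ℕtoℚ-* e q ⟩
      ℕtoℚ e * Q                           ≡⟨ ℚP.*-comm (ℕtoℚ e) Q ⟩
      Q * ℕtoℚ e                           ∎
      where open ≡-Reasoning

  Members : ℤ → Set
  Members d = d ≡ + 1 ⊎ d ≡ + 2 ⊎ d ≡ + p ⊎ d ≡ + (2 ℕ.* p)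

  rep-positive : ∀ a b → rep p false a b false ≡ + (2 ^ bit a ℕ.* p ^ bit b)
  rep-positive a b = trans (ℤP.*-identityˡ _) (cong +_ (ℕP.*-identityʳ _))

  classify : ∀ s a b c → InSelmer p (rep p s a b c) → Members (rep p s a b c)
  classify true  a     b     c     h = ⊥-elim (¬InSelmer-negative a b c h)
  classify false a     b     true  h = ⊥-elim (¬InSelmer-q a b h)
  classify false false false false _ = inj₁ (rep-positive false false)
  classify false true  false false _ = inj₂ (inj₁ (rep-positive true false))
  classify false false true  false _ =
    inj₂ (inj₂ (inj₁ (trans (rep-positive false true) (cong +_ (trans (ℕP.*-identityˡ (p ℕ.* 1)) (ℕP.*-identityʳ p))))))
  classify false true  true  false _ =
    inj₂ (inj₂ (inj₂ (trans (rep-positive true true) (cong (λ t → + (2 ℕ.* t)) (ℕP.*-identityʳ p)))))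

  members-InSelmer : ∀ {d} → Members d → InSelmer p d
  members-InSelmer (inj₁ refl)               = InSelmer-1
  members-InSelmer (inj₂ (inj₁ refl))        = InSelmer-2
  members-InSelmer (inj₂ (inj₂ (inj₁ refl))) = InSelmer-p
  members-InSelmer (inj₂ (inj₂ (inj₂ refl))) = InSelmer-2p

open import Data.Nat using (_∸_; _%_; _*_)
open import Function.Bundles using (_⇔_; mk⇔)

lemma2 : (p : ℕ) → Prime p → Prime (p ∸ 2) → p % 8 ≡ 5 →
         (s a b c : Bool) →
         InSelmer p (rep p s a b c) ⇔
           (rep p s a b c ≡ + 1 ⊎ rep p s a b c ≡ + 2 ⊎ rep p s a b c ≡ + p ⊎ rep p s a b c ≡ + (2 * p))
lemma2 p p-prime q-prime p≡5[8] s a b c = mk⇔ (classify s a b c) members-InSelmer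
  where open SelmerGroup p p-prime q-prime p≡5[8]
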